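{- Let $k$ be a positive integer and let $a,b$ be integers with $1\le a<b\le k$. Let $\mathcal{P}_{a,b,k}$ be the set of all partitions (including the empty partition) all of whose parts are congruent to $a$ or $b$ modulo $k$. Then, as formal power series (or for $|q|<1$), \[ \sum_{\pi\in\mathcal{P}_{a,b,k}}\mu^{\ell_{a}(\pi)}\nu^{\ell_{b}(\pi)}q^{|\pi|} =\sum_{m,h,i\geq 0}\frac{\mu^{m-h-i}\nu^{h+i}q^{ma+kh^2+(b-a)(h+i)}}{(q^k;q^k)_m}{{h+i}\brack{h}}_k{{m-h-i}\brack{h}}_k . \]
   Context: For a partition $\pi$, $|\pi|$ is the sum of its parts, and $\ell_a(\pi)$ (resp. $\ell_b(\pi)$) is the number of parts of $\pi$ congruent to $a$ (resp. $b$) modulo $k$. $(x;q)_n=\prod_{i=0}^{n-1}(1-xq^i)$. For non-negative integers $A,B$, the Gaussian polynomial is ${A\brack B}_k=\frac{(q^k;q^k)_A}{(q^k;q^k)_B(q^k;q^k)_{A-B}}$ if $A\ge B\ge 0$, and $0$ otherwise; this convention is also used when an entry is negative. -}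

module Defs where

open import Data.Bool using (Bool; true; false; if_then_else_; _∧_)
open import Data.Nat as ℕ using (ℕ; zero; suc; _∸_; _≡ᵇ_; _≤ᵇ_; NonZero; _%_; _≥_)
open import Data.Nat.Divisibility using (_∣?_)
open import Data.Integer as ℤ using (ℤ; +_; _-_)
open import Data.List using (List; []; _∷_; length; filter)
open import Data.Nat.ListAction using (sum)
open import Data.List.Relation.Unary.All using (All)
open import Data.List.Relation.Unary.Linked using (Linked)
open import Data.Product using (_×_)
open import Data.Sum using (_⊎_)
open import Relation.Nullary.Decidable using (does)
open import Relation.Binary.PropositionalEquality using (_≡_)

-- Formal power series in q with integer coefficients:
-- a series is its coefficient function  n ↦ [q^n] f.

Series : Set
Series = ℕ → ℤ

sumTo : ℕ → (ℕ → ℤ) → ℤ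
sumTo zero    f = f 0
sumTo (suc n) f = sumTo n f ℤ.+ f (suc n)

_⊛_ : Series → Series → Series
(f ⊛ g) n = sumTo n (λ i → f i ℤ.* g (n ∸ i))

infixl 7 _⊛_

qPow : ℕ → Series
qPow e n = if n ≡ᵇ e then + 1 else + 0

one : Series
one = qPow 0

zeroS : Series
zeroS _ = + 0

oneMinusQ : ℕ → Series
oneMinusQ j n = one n - qPow j n

poch : ℕ → ℕ → Series
poch k zero    = one
poch k (suc m) = poch k m ⊛ oneMinusQ (k ℕ.* suc m)

-- the formal inverse of (1 - q^j) for j > 0, i.e. the series Σ_t q^{j t}
invOneMinusQ : ℕ → Series
invOneMinusQ j n = if does (j ∣? n) then + 1 else + 0

invPoch : ℕ → ℕ → Series
invPoch k zero    = one
invPoch k (suc m) = invPoch k m ⊛ invOneMinusQ (k ℕ.* suc m)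

gauss : ℕ → ℕ → ℕ → Series
gauss k A B = if B ≤ᵇ A then poch k A ⊛ invPoch k B ⊛ invPoch k (A ∸ B) else zeroS

-- Right-hand side.  A series in μ, ν, q is given by its coefficient
-- function (r , s , n) ↦ [μ^r ν^s q^n].

termQ : (k a b m h i : ℕ) → Series
termQ k a b m h i =
  qPow (m ℕ.* a ℕ.+ k ℕ.* (h ℕ.* h) ℕ.+ (b ∸ a) ℕ.* (h ℕ.+ i))
    ⊛ invPoch k m ⊛ gauss k (h ℕ.+ i) h ⊛ gauss k (m ∸ (h ℕ.+ i)) h

-- [μ^r ν^s q^n] of the (m,h,i)-summand  μ^{m-h-i} ν^{h+i} termQ.
-- If m < h+i the Gaussian [m-h-i brack h] vanishes (negative entry), so the
-- summand is 0.
termCoeff : (k a b m h i r s n : ℕ) → ℤ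
termCoeff k a b m h i r s n =
  if (h ℕ.+ i ≤ᵇ m) ∧ ((m ∸ (h ℕ.+ i)) ≡ᵇ r) ∧ ((h ℕ.+ i) ≡ᵇ s)
  then termQ k a b m h i n else + 0

-- Only summands with
-- m-h-i = r and h+i = s contribute, all of which have m ≤ r+s, h ≤ s, i ≤ s,
-- so the (formally convergent) triple sum reduces to this finite one.
rhsCoeff : (k a b r s n : ℕ) → ℤ
rhsCoeff k a b r s n =
  sumTo (r ℕ.+ s) λ m → sumTo s λ h → sumTo s λ i → termCoeff k a b m h i r s n

IsPartition : List ℕ → Set
IsPartition π = Linked _≥_ π × All (λ x → 1 ℕ.≤ x) π

ℓ : (k c : ℕ) .{{_ : NonZero k}} → List ℕ → ℕ
ℓ k c π = length (filter (λ x → x % k ℕ.≟ c % k) π)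

InP : (k a b : ℕ) .{{_ : NonZero k}} → List ℕ → Set
InP k a b π = IsPartition π × All (λ x → (x % k ≡ a % k) ⊎ (x % k ≡ b % k)) π

PartCell : (k a b n r s : ℕ) .{{_ : NonZero k}} → List ℕ → Set
PartCell k a b n r s π = InP k a b π × sum π ≡ n × ℓ k a π ≡ r × ℓ k b π ≡ s

-- Both sides have coefficient q^{ra+sb} / ((q^k;q^k)_r (q^k;q^k)_s) at μ^r ν^s.
-- On the right only m = r + s and i = s - h contribute, and the sum over h collapses by the
-- q-Vandermonde identity  Σ_h q^{kh²} [s,h]_k [r,h]_k = [r+s,s]_k,  itself a consequence of the
-- q-Pascal recurrence.  On the left the partitions are enumerated from their smallest part: it is
-- a, or it is b, or all parts exceed k and k can be subtracted from each of them.  The three cases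
-- give exactly the recurrences that 1/(1 - q^j) = 1 + q^j/(1 - q^j) gives for the product above.
module Submission where

open import Defs
open import Algebra.Bundles using (CommutativeRing)
import Algebra.Properties.CommutativeSemigroup as CommutativeSemigroupProperties
import Algebra.Properties.Ring as RingProperties
import Algebra.Solver.CommutativeMonoid as CommutativeMonoidSolver
open import Data.Bool using (true; false; if_then_else_; T)
open import Data.List using (List; []; _∷_; _++_; map; length; reverse)
import Data.List.Properties as List
open import Data.List.Relation.Unary.All as All using (All; []; _∷_)
import Data.List.Relation.Unary.All.Properties as Allₚ
open import Data.List.Relation.Unary.Any using (here)
open import Data.List.Membership.Propositional using (_∈_)
open import Data.List.Membership.Propositional.Properties using (∈-map⁺; ∈-map⁻; ∈-++⁺ˡ; ∈-++⁺ʳ; ∈-++⁻)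
open import Data.List.Relation.Unary.Unique.Propositional using (Unique)
import Data.List.Relation.Unary.Unique.Propositional.Properties as Uniqueₚ
open import Data.List.Relation.Binary.Disjoint.Propositional using (Disjoint)
open import Data.List.Relation.Unary.AllPairs using (AllPairs; []; _∷_)
import Data.List.Relation.Unary.AllPairs.Properties as AllPairs
open import Data.List.Relation.Unary.Linked as Linked using (Linked; []; [-]; _∷_)
import Data.List.Relation.Unary.Linked.Properties as Linkedₚ
import Data.List.Relation.Binary.Permutation.Propositional as ↭
import Data.List.Relation.Binary.Permutation.Propositional.Properties as ↭ₚ
import Data.Nat.DivMod as DivMod
open import Data.Nat.ListAction using (sum)
import Data.Nat.ListAction.Properties as ListActionₚ
open import Data.Nat.Induction using (<-wellFounded)
open import Induction.WellFounded using (Acc; acc)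
open import Data.Integer as ℤ using (ℤ; +_)
import Data.Integer.Properties as ℤₚ
open import Data.Nat
import Data.Nat.Properties as ℕₚ
import Data.Nat.Tactic.RingSolver as ℕ-Solver
import Data.Integer.Tactic.RingSolver as ℤ-Solver
import Relation.Binary.Reasoning.Setoid
open import Data.Nat.Divisibility using (_∣_; _∣?_; _∣0; ∣-refl; ∣⇒≤; ∣m+n∣m⇒∣n; ∣m∣n⇒∣m+n)
open import Data.Product using (_×_; _,_; proj₁; proj₂; ∃-syntax)
open import Data.Sum using (_⊎_; inj₁; inj₂)
open import Function using (_∘_; flip)
open import Level using (0ℓ)
open import Relation.Binary.PropositionalEquality
open import Relation.Binary.Definitions using (Transitive; tri<; tri≈; tri>)
open import Relation.Nullary using (¬_; Dec; yes; no; does)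
open import Relation.Nullary.Decidable using (dec-true; dec-false; does-⇔)
open import Relation.Nullary.Negation using (contradiction)
open import Function.Bundles using (_⇔_; mk⇔)

sumTo-cong : ∀ n {f g : ℕ → ℤ} → (∀ i → i ≤ n → f i ≡ g i) → sumTo n f ≡ sumTo n g
sumTo-cong zero    f≡g = f≡g 0 z≤n
sumTo-cong (suc n) f≡g =
  cong₂ ℤ._+_ (sumTo-cong n λ i i≤n → f≡g i (ℕₚ.m≤n⇒m≤1+n i≤n)) (f≡g (suc n) ℕₚ.≤-refl)

sumTo-+ : ∀ n (f g : ℕ → ℤ) → sumTo n (λ i → f i ℤ.+ g i) ≡ sumTo n f ℤ.+ sumTo n g
sumTo-+ zero    f g = refl
sumTo-+ (suc n) f g = trans (cong (ℤ._+ (f (suc n) ℤ.+ g (suc n))) (sumTo-+ n f g))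
                            (interchange (sumTo n f) (sumTo n g) (f (suc n)) (g (suc n)))
  where open CommutativeSemigroupProperties ℤₚ.+-commutativeSemigroup using (interchange)

sumTo-*ˡ : ∀ n c (f : ℕ → ℤ) → sumTo n (λ i → c ℤ.* f i) ≡ c ℤ.* sumTo n f
sumTo-*ˡ zero    c f = refl
sumTo-*ˡ (suc n) c f =
  trans (cong (ℤ._+ c ℤ.* f (suc n)) (sumTo-*ˡ n c f)) (sym (ℤₚ.*-distribˡ-+ c (sumTo n f) (f (suc n))))

sumTo-neg : ∀ n (f : ℕ → ℤ) → sumTo n (λ i → ℤ.- f i) ≡ ℤ.- sumTo n f
sumTo-neg zero    f = refl
sumTo-neg (suc n) f =
  trans (cong (ℤ._+ ℤ.- f (suc n)) (sumTo-neg n f)) (sym (ℤₚ.neg-distrib-+ (sumTo n f) (f (suc n))))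

sumTo-unfoldˡ : ∀ n (f : ℕ → ℤ) → sumTo (suc n) f ≡ f 0 ℤ.+ sumTo n (f ∘ suc)
sumTo-unfoldˡ zero    f = refl
sumTo-unfoldˡ (suc n) f =
  trans (cong (ℤ._+ f (suc (suc n))) (sumTo-unfoldˡ n f)) (ℤₚ.+-assoc (f 0) (sumTo n (f ∘ suc)) (f (suc (suc n))))

sumTo-reverse : ∀ n (f : ℕ → ℤ) → sumTo n f ≡ sumTo n (λ i → f (n ∸ i))
sumTo-reverse zero    f = refl
sumTo-reverse (suc n) f = begin
  sumTo n f ℤ.+ f (suc n)                   ≡⟨ ℤₚ.+-comm (sumTo n f) (f (suc n)) ⟩
  f (suc n) ℤ.+ sumTo n f                   ≡⟨ cong (λ z → f (suc n) ℤ.+ z) (sumTo-reverse n f) ⟩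
  f (suc n) ℤ.+ sumTo n (λ i → f (n ∸ i))   ≡⟨ sumTo-unfoldˡ n (λ i → f (suc n ∸ i)) ⟨
  sumTo (suc n) (λ i → f (suc n ∸ i))       ∎
  where open ≡-Reasoning

sumTo-≡0 : ∀ n (f : ℕ → ℤ) → (∀ i → i ≤ n → f i ≡ + 0) → sumTo n f ≡ + 0
sumTo-≡0 n f f≡0 = trans (sumTo-cong n f≡0) (constant n)
  where
  constant : ∀ n → sumTo n (λ _ → + 0) ≡ + 0
  constant zero    = refl
  constant (suc n) = cong (ℤ._+ + 0) (constant n)

sumTo-single : ∀ n j (f : ℕ → ℤ) → j ≤ n → (∀ i → i ≤ n → i ≢ j → f i ≡ + 0) → sumTo n f ≡ f j
sumTo-single zero    .zero f z≤n _    = refl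
sumTo-single (suc n) j     f j≤1+n f≡0 with j ≟ suc n
... | yes refl = begin
  sumTo n f ℤ.+ f (suc n) ≡⟨ cong (ℤ._+ f (suc n)) (sumTo-≡0 n f λ i i≤n →
                               f≡0 i (ℕₚ.m≤n⇒m≤1+n i≤n) (ℕₚ.<⇒≢ (s≤s i≤n))) ⟩
  + 0 ℤ.+ f (suc n)       ≡⟨ ℤₚ.+-identityˡ (f (suc n)) ⟩
  f (suc n)               ∎
  where open ≡-Reasoning
... | no j≢1+n = begin
  sumTo n f ℤ.+ f (suc n) ≡⟨ cong (λ z → sumTo n f ℤ.+ z) (f≡0 (suc n) ℕₚ.≤-refl (j≢1+n ∘ sym)) ⟩
  sumTo n f ℤ.+ + 0       ≡⟨ ℤₚ.+-identityʳ (sumTo n f) ⟩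
  sumTo n f               ≡⟨ sumTo-single n j f j≤n (λ i i≤n → f≡0 i (ℕₚ.m≤n⇒m≤1+n i≤n)) ⟩
  f j                     ∎
  where
  open ≡-Reasoning
  j≤n : j ≤ n
  j≤n = ℕₚ.≤-pred (ℕₚ.≤∧≢⇒< j≤1+n j≢1+n)

-- The ring of formal power series

-- A record rather than the pointwise equality itself, so that Agda can infer f and g from f ≈ g.
infix 4 _≈_
record _≈_ (f g : Series) : Set where
  constructor mk≈
  field at : ∀ n → f n ≡ g n
open _≈_ public

infixl 6 _⊕_
_⊕_ : Series → Series → Series
(f ⊕ g) n = f n ℤ.+ g n

neg : Series → Series
neg f n = ℤ.- f n

≈-refl : ∀ {f} → f ≈ f
≈-refl = mk≈ λ _ → refl

≈-sym : ∀ {f g} → f ≈ g → g ≈ f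
≈-sym f≈g = mk≈ λ n → sym (at f≈g n)

≈-trans : ∀ {f g h} → f ≈ g → g ≈ h → f ≈ h
≈-trans f≈g g≈h = mk≈ λ n → trans (at f≈g n) (at g≈h n)

⊛-cong : ∀ {f f′ g g′} → f ≈ f′ → g ≈ g′ → f ⊛ g ≈ f′ ⊛ g′
⊛-cong f≈f′ g≈g′ = mk≈ λ n → sumTo-cong n λ i _ → cong₂ ℤ._*_ (at f≈f′ i) (at g≈g′ (n ∸ i))

⊛-comm : ∀ f g → f ⊛ g ≈ g ⊛ f
⊛-comm f g = mk≈ λ n → trans (sumTo-reverse n _) (sumTo-cong n λ i i≤n →
  trans (cong (λ j → f (n ∸ i) ℤ.* g j) (ℕₚ.m∸[m∸n]≡n i≤n)) (ℤₚ.*-comm (f (n ∸ i)) (g i)))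

⊛-distribʳ : ∀ f g h → (g ⊕ h) ⊛ f ≈ g ⊛ f ⊕ h ⊛ f
⊛-distribʳ f g h = mk≈ λ n →
  trans (sumTo-cong n λ i _ → ℤₚ.*-distribʳ-+ (f (n ∸ i)) (g i) (h i)) (sumTo-+ n _ _)

⊛-distribˡ : ∀ f g h → f ⊛ (g ⊕ h) ≈ f ⊛ g ⊕ f ⊛ h
⊛-distribˡ f g h = mk≈ λ n →
  trans (sumTo-cong n λ i _ → ℤₚ.*-distribˡ-+ (f i) (g (n ∸ i)) (h (n ∸ i))) (sumTo-+ n _ _)

⊛-negˡ : ∀ f g → neg f ⊛ g ≈ neg (f ⊛ g)
⊛-negˡ f g = mk≈ λ n →
  trans (sumTo-cong n λ i _ → sym (ℤₚ.neg-distribˡ-* (f i) (g (n ∸ i)))) (sumTo-neg n _)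

⊛-zeroˡ : ∀ f → zeroS ⊛ f ≈ zeroS
⊛-zeroˡ f = mk≈ λ n → sumTo-≡0 n _ λ _ _ → refl

⊛-coeff-suc : ∀ f g n → (f ⊛ g) (suc n) ≡ f 0 ℤ.* g (suc n) ℤ.+ ((f ∘ suc) ⊛ g) n
⊛-coeff-suc f g n = sumTo-unfoldˡ n (λ i → f i ℤ.* g (suc n ∸ i))

⊛-identityˡ : ∀ f → one ⊛ f ≈ f
⊛-identityˡ f = mk≈ identity
  where
  open ≡-Reasoning
  identity : ∀ n → (one ⊛ f) n ≡ f n
  identity zero    = ℤₚ.*-identityˡ (f 0)
  identity (suc n) = begin
    (one ⊛ f) (suc n)                        ≡⟨ ⊛-coeff-suc one f n ⟩
    + 1 ℤ.* f (suc n) ℤ.+ (zeroS ⊛ f) n      ≡⟨ cong₂ ℤ._+_ (ℤₚ.*-identityˡ (f (suc n))) (at (⊛-zeroˡ f) n) ⟩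
    f (suc n) ℤ.+ + 0                        ≡⟨ ℤₚ.+-identityʳ (f (suc n)) ⟩
    f (suc n)                                ∎

-- The coefficient of q^(n+1) in (f ⊛ g) ⊛ h peels off the constant terms of f and g.
⊛-assoc : ∀ f g h → (f ⊛ g) ⊛ h ≈ f ⊛ (g ⊛ h)
⊛-assoc f g h = mk≈ (assoc f g h)
  where
  open ≡-Reasoning
  assoc : ∀ f g h n → ((f ⊛ g) ⊛ h) n ≡ (f ⊛ (g ⊛ h)) n
  assoc f g h zero    = ℤₚ.*-assoc (f 0) (g 0) (h 0)
  assoc f g h (suc n) = begin
    ((f ⊛ g) ⊛ h) (suc n)
      ≡⟨ ⊛-coeff-suc (f ⊛ g) h n ⟩
    f₀ ℤ.* g₀ ℤ.* h (suc n) ℤ.+ (((f ⊛ g) ∘ suc) ⊛ h) n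
      ≡⟨ cong (λ z → f₀ ℤ.* g₀ ℤ.* h (suc n) ℤ.+ z) (at (⊛-cong {g = h} (mk≈ (⊛-coeff-suc f g)) ≈-refl) n) ⟩
    f₀ ℤ.* g₀ ℤ.* h (suc n) ℤ.+ (((λ m → f₀ ℤ.* g (suc m)) ⊕ ((f ∘ suc) ⊛ g)) ⊛ h) n
      ≡⟨ cong (λ z → f₀ ℤ.* g₀ ℤ.* h (suc n) ℤ.+ z)
              (at (⊛-distribʳ h (λ m → f₀ ℤ.* g (suc m)) ((f ∘ suc) ⊛ g)) n) ⟩
    f₀ ℤ.* g₀ ℤ.* h (suc n) ℤ.+ (((λ m → f₀ ℤ.* g (suc m)) ⊛ h) n ℤ.+ (((f ∘ suc) ⊛ g) ⊛ h) n)
      ≡⟨ cong₂ (λ u v → f₀ ℤ.* g₀ ℤ.* h (suc n) ℤ.+ (u ℤ.+ v)) scale (assoc (f ∘ suc) g h n) ⟩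
    f₀ ℤ.* g₀ ℤ.* h (suc n) ℤ.+ (f₀ ℤ.* ((g ∘ suc) ⊛ h) n ℤ.+ ((f ∘ suc) ⊛ (g ⊛ h)) n)
      ≡⟨ regroup f₀ g₀ (h (suc n)) (((g ∘ suc) ⊛ h) n) (((f ∘ suc) ⊛ (g ⊛ h)) n) ⟩
    f₀ ℤ.* (g₀ ℤ.* h (suc n) ℤ.+ ((g ∘ suc) ⊛ h) n) ℤ.+ ((f ∘ suc) ⊛ (g ⊛ h)) n
      ≡⟨ cong (λ z → f₀ ℤ.* z ℤ.+ ((f ∘ suc) ⊛ (g ⊛ h)) n) (⊛-coeff-suc g h n) ⟨
    f₀ ℤ.* (g ⊛ h) (suc n) ℤ.+ ((f ∘ suc) ⊛ (g ⊛ h)) n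
      ≡⟨ ⊛-coeff-suc f (g ⊛ h) n ⟨
    (f ⊛ (g ⊛ h)) (suc n) ∎
    where
    f₀ = f 0
    g₀ = g 0
    scale : ((λ m → f₀ ℤ.* g (suc m)) ⊛ h) n ≡ f₀ ℤ.* ((g ∘ suc) ⊛ h) n
    scale = trans (sumTo-cong n λ i _ → ℤₚ.*-assoc f₀ (g (suc i)) (h (n ∸ i))) (sumTo-*ˡ n f₀ _)
    regroup : ∀ a b c d e → a ℤ.* b ℤ.* c ℤ.+ (a ℤ.* d ℤ.+ e) ≡ a ℤ.* (b ℤ.* c ℤ.+ d) ℤ.+ e
    regroup = ℤ-Solver.solve-∀

seriesRing : CommutativeRing 0ℓ 0ℓ
seriesRing = record
  { Carrier = Series ; _≈_ = _≈_ ; _+_ = _⊕_ ; _*_ = _⊛_ ; -_ = neg ; 0# = zeroS ; 1# = one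
  ; isCommutativeRing = record
    { isRing = record
      { +-isAbelianGroup = record
        { isGroup = record
          { isMonoid = record
            { isSemigroup = record
              { isMagma = record
                { isEquivalence = record { refl = ≈-refl ; sym = ≈-sym ; trans = ≈-trans }
                ; ∙-cong = λ f≈f′ g≈g′ → mk≈ λ n → cong₂ ℤ._+_ (at f≈f′ n) (at g≈g′ n) }
              ; assoc = λ f g h → mk≈ λ n → ℤₚ.+-assoc (f n) (g n) (h n) }
            ; identity = (λ f → mk≈ λ n → ℤₚ.+-identityˡ (f n)) , (λ f → mk≈ λ n → ℤₚ.+-identityʳ (f n)) }
          ; inverse = (λ f → mk≈ λ n → ℤₚ.+-inverseˡ (f n)) , (λ f → mk≈ λ n → ℤₚ.+-inverseʳ (f n))
          ; ⁻¹-cong = λ f≈g → mk≈ λ n → cong ℤ.-_ (at f≈g n) }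
        ; comm = λ f g → mk≈ λ n → ℤₚ.+-comm (f n) (g n) }
      ; *-cong = ⊛-cong
      ; *-assoc = ⊛-assoc
      ; *-identity = ⊛-identityˡ , λ f → ≈-trans (⊛-comm f one) (⊛-identityˡ f)
      ; distrib = ⊛-distribˡ , ⊛-distribʳ }
    ; *-comm = ⊛-comm } }

open CommutativeRing seriesRing
  using (*-commutativeMonoid)
  renaming (+-cong to ⊕-cong ; *-identityʳ to ⊛-identityʳ ; zeroʳ to ⊛-zeroʳ)
open RingProperties (CommutativeRing.ring seriesRing)
  using () renaming (-‿distribʳ-* to ⊛-negʳ)
open CommutativeSemigroupProperties (CommutativeRing.+-commutativeSemigroup seriesRing)
  using () renaming (xy∙z≈xz∙y to ⊕-swapʳ)

⊛-congˡ : ∀ f {g g′} → g ≈ g′ → f ⊛ g ≈ f ⊛ g′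
⊛-congˡ f = ⊛-cong (≈-refl {f})

⊛-congʳ : ∀ h {f f′} → f ≈ f′ → f ⊛ h ≈ f′ ⊛ h
⊛-congʳ h f≈f′ = ⊛-cong f≈f′ (≈-refl {h})

⊕-congˡ : ∀ f {g g′} → g ≈ g′ → f ⊕ g ≈ f ⊕ g′
⊕-congˡ f = ⊕-cong (≈-refl {f})

⊕-congʳ : ∀ h {f f′} → f ≈ f′ → f ⊕ h ≈ f′ ⊕ h
⊕-congʳ h f≈f′ = ⊕-cong f≈f′ (≈-refl {h})

module ≈-Reasoning = Relation.Binary.Reasoning.Setoid (CommutativeRing.setoid seriesRing)
-- The solver's monoid operation gets the fixity of _⊛_, so that its terms match goals syntactically.
open CommutativeMonoidSolver *-commutativeMonoid using (solve; _⊜_) renaming (_⊕_ to infixl 7 _∙_)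

⊛-cancelʳ : ∀ f g h → g ⊛ h ≈ one → f ⊛ (g ⊛ h) ≈ f
⊛-cancelʳ f g h gh≈1 = ≈-trans (⊛-congˡ f gh≈1) (⊛-identityʳ f)

∑ : ℕ → (ℕ → Series) → Series
∑ K F n = sumTo K (λ j → F j n)

∑-cong : ∀ K {F G : ℕ → Series} → (∀ j → j ≤ K → F j ≈ G j) → ∑ K F ≈ ∑ K G
∑-cong K F≈G = mk≈ λ n → sumTo-cong K λ j j≤K → at (F≈G j j≤K) n

∑-⊕ : ∀ K (F G : ℕ → Series) → ∑ K (λ j → F j ⊕ G j) ≈ ∑ K F ⊕ ∑ K G
∑-⊕ K F G = mk≈ λ n → sumTo-+ K (λ j → F j n) (λ j → G j n)

⊛-∑ : ∀ K f (F : ℕ → Series) → f ⊛ ∑ K F ≈ ∑ K (λ j → f ⊛ F j)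
⊛-∑ zero    f F = ≈-refl
⊛-∑ (suc K) f F = ≈-trans (⊛-distribˡ f (∑ K F) (F (suc K))) (⊕-congʳ (f ⊛ F (suc K)) (⊛-∑ K f F))

∑-reverse : ∀ K (F : ℕ → Series) → ∑ K F ≈ ∑ K (λ j → F (K ∸ j))
∑-reverse K F = mk≈ λ n → sumTo-reverse K (λ j → F j n)

∑-single : ∀ K (F : ℕ → Series) → (∀ j → j < K → F j ≈ zeroS) → ∑ K F ≈ F K
∑-single K F F≈0 = mk≈ λ n →
  sumTo-single K K (λ j → F j n) ℕₚ.≤-refl λ j j≤K j≢K → at (F≈0 j (ℕₚ.≤∧≢⇒< j≤K j≢K)) n

qPow-below : ∀ e n → n < e → qPow e n ≡ + 0
qPow-below (suc e) zero    _         = refl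
qPow-below (suc e) (suc n) (s≤s n<e) = qPow-below e n n<e

qPow-⊛-below : ∀ e f n → n < e → (qPow e ⊛ f) n ≡ + 0
qPow-⊛-below (suc e) f zero    _         = refl
qPow-⊛-below (suc e) f (suc n) (s≤s n<e) =
  trans (⊛-coeff-suc (qPow (suc e)) f n) (trans (ℤₚ.+-identityˡ _) (qPow-⊛-below e f n n<e))

qPow-⊛-shift : ∀ e f m → (qPow e ⊛ f) (e + m) ≡ f m
qPow-⊛-shift zero    f m = at (⊛-identityˡ f) m
qPow-⊛-shift (suc e) f m =
  trans (⊛-coeff-suc (qPow (suc e)) f (e + m)) (trans (ℤₚ.+-identityˡ _) (qPow-⊛-shift e f m))

qPow-⊛ : ∀ e f n → e ≤ n → (qPow e ⊛ f) n ≡ f (n ∸ e)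
qPow-⊛ e f n e≤n = subst (λ z → (qPow e ⊛ f) z ≡ f (n ∸ e)) (ℕₚ.m+[n∸m]≡n e≤n) (qPow-⊛-shift e f (n ∸ e))

qPow-+ : ∀ e e′ → qPow e ⊛ qPow e′ ≈ qPow (e + e′)
qPow-+ e e′ = mk≈ coeff
  where
  shift : ∀ e m → qPow (e + e′) (e + m) ≡ qPow e′ m
  shift zero    m = refl
  shift (suc e) m = shift e m
  coeff : ∀ n → (qPow e ⊛ qPow e′) n ≡ qPow (e + e′) n
  coeff n with n <? e
  ... | yes n<e = trans (qPow-⊛-below e (qPow e′) n n<e)
                        (sym (qPow-below (e + e′) n (ℕₚ.<-≤-trans n<e (ℕₚ.m≤m+n e e′))))
  ... | no n≮e with ℕₚ.m≤n⇒∃[o]m+o≡n (ℕₚ.≮⇒≥ n≮e)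
  ...   | m , refl = trans (qPow-⊛-shift e (qPow e′) m) (sym (shift e m))

qPow-cong : ∀ {e e′} → e ≡ e′ → qPow e ≈ qPow e′
qPow-cong refl = ≈-refl

oneMinusQ-+ : ∀ A B → oneMinusQ (A + B) ≈ oneMinusQ A ⊕ qPow A ⊛ oneMinusQ B
oneMinusQ-+ A B = mk≈ λ n → sym (begin
  (one n ℤ.- qPow A n) ℤ.+ (qPow A ⊛ (one ⊕ neg (qPow B))) n
    ≡⟨ cong (λ z → (one n ℤ.- qPow A n) ℤ.+ z) (at qAB n) ⟩
  (one n ℤ.- qPow A n) ℤ.+ (qPow A n ℤ.- qPow (A + B) n)
    ≡⟨ telescope (one n) (qPow A n) (qPow (A + B) n) ⟩
  one n ℤ.- qPow (A + B) n ∎)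
  where
  open ≡-Reasoning
  qAB : qPow A ⊛ (one ⊕ neg (qPow B)) ≈ qPow A ⊕ neg (qPow (A + B))
  qAB = ≈-trans (⊛-distribˡ (qPow A) one (neg (qPow B)))
                (⊕-cong (⊛-identityʳ (qPow A))
                        (≈-trans (≈-sym (⊛-negʳ (qPow A) (qPow B))) (mk≈ λ n → cong ℤ.-_ (at (qPow-+ A B) n))))
  telescope : ∀ x y z → (x ℤ.- y) ℤ.+ (y ℤ.- z) ≡ x ℤ.- z
  telescope = ℤ-Solver.solve-∀

invOneMinusQ-unfold : ∀ j .{{_ : NonZero j}} → invOneMinusQ j ≈ one ⊕ qPow j ⊛ invOneMinusQ j
invOneMinusQ-unfold j@(suc _) = mk≈ coeff
  where
  indicator : ∀ n {b} → does (j ∣? n) ≡ b → invOneMinusQ j n ≡ (if b then + 1 else + 0)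
  indicator n = cong (if_then + 1 else + 0)
  coeff : ∀ n → invOneMinusQ j n ≡ one n ℤ.+ (qPow j ⊛ invOneMinusQ j) n
  coeff n with n <? j
  coeff zero    | yes _   = indicator 0 (dec-true (j ∣? 0) (j ∣0))
  coeff (suc n) | yes n<j = begin
    invOneMinusQ j (suc n)
      ≡⟨ indicator (suc n) (dec-false (j ∣? suc n) λ j∣1+n → ℕₚ.<⇒≱ n<j (∣⇒≤ j∣1+n)) ⟩
    + 0
      ≡⟨ qPow-⊛-below j (invOneMinusQ j) (suc n) n<j ⟨
    (qPow j ⊛ invOneMinusQ j) (suc n)
      ≡⟨ ℤₚ.+-identityˡ _ ⟨
    one (suc n) ℤ.+ (qPow j ⊛ invOneMinusQ j) (suc n) ∎
    where open ≡-Reasoning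
  ... | no n≮j with ℕₚ.m≤n⇒∃[o]m+o≡n (ℕₚ.≮⇒≥ n≮j)
  ...   | m , refl = begin
    invOneMinusQ j (j + m)
      ≡⟨ indicator (j + m) (does-⇔ j∣j+m⇔j∣m (j ∣? (j + m)) (j ∣? m)) ⟩
    invOneMinusQ j m
      ≡⟨ qPow-⊛-shift j (invOneMinusQ j) m ⟨
    (qPow j ⊛ invOneMinusQ j) (j + m)
      ≡⟨ ℤₚ.+-identityˡ _ ⟨
    one (j + m) ℤ.+ (qPow j ⊛ invOneMinusQ j) (j + m) ∎
    where
    open ≡-Reasoning
    j∣j+m⇔j∣m : j ∣ j + m ⇔ j ∣ m
    j∣j+m⇔j∣m = mk⇔ (λ j∣j+m → ∣m+n∣m⇒∣n j∣j+m ∣-refl) (∣m∣n⇒∣m+n ∣-refl)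

oneMinusQ-inverse : ∀ j .{{_ : NonZero j}} → oneMinusQ j ⊛ invOneMinusQ j ≈ one
oneMinusQ-inverse j = begin
  (one ⊕ neg (qPow j)) ⊛ I                 ≈⟨ ⊛-distribʳ I one (neg (qPow j)) ⟩
  one ⊛ I ⊕ neg (qPow j) ⊛ I               ≈⟨ ⊕-cong (≈-trans (⊛-identityˡ I) (invOneMinusQ-unfold j))
                                                      (⊛-negˡ (qPow j) I) ⟩
  one ⊕ qPow j ⊛ I ⊕ neg (qPow j ⊛ I)      ≈⟨ mk≈ (λ n → cancel (one n) ((qPow j ⊛ I) n)) ⟩
  one                                      ∎
  where
  open ≈-Reasoning
  I = invOneMinusQ j
  cancel : ∀ x y → x ℤ.+ y ℤ.+ ℤ.- y ≡ x
  cancel = ℤ-Solver.solve-∀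

⊛-invOneMinusQ-unfold : ∀ j .{{_ : NonZero j}} f → f ⊛ invOneMinusQ j ≈ f ⊕ qPow j ⊛ (f ⊛ invOneMinusQ j)
⊛-invOneMinusQ-unfold j f = begin
  f ⊛ I                       ≈⟨ ⊛-congˡ f (invOneMinusQ-unfold j) ⟩
  f ⊛ (one ⊕ qPow j ⊛ I)      ≈⟨ ⊛-distribˡ f one (qPow j ⊛ I) ⟩
  f ⊛ one ⊕ f ⊛ (qPow j ⊛ I)  ≈⟨ ⊕-cong (⊛-identityʳ f)
                                         (solve 3 (λ f x i → f ∙ (x ∙ i) ⊜ x ∙ (f ∙ i)) ≈-refl f (qPow j) I) ⟩
  f ⊕ qPow j ⊛ (f ⊛ I)        ∎
  where
  open ≈-Reasoning
  I = invOneMinusQ j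

qPow-⊛-split : ∀ c e f g → qPow (c + e) ⊛ f ⊛ g ≈ qPow c ⊛ (qPow e ⊛ f ⊛ g)
qPow-⊛-split c e f g = ≈-trans (⊛-congʳ g (⊛-congʳ f (≈-sym (qPow-+ c e))))
                               (solve 4 (λ x y f g → x ∙ y ∙ f ∙ g ⊜ x ∙ (y ∙ f ∙ g)) ≈-refl (qPow c) (qPow e) f g)

-- q-Pochhammer symbols and Gaussian polynomials in base q^k

vandermonde-exponent : ∀ {m n K j} → j ≤ m → j ≤ K → K ∸ j ≤ n →
  (m ∸ j) * (suc K ∸ j) + (n ∸ (K ∸ j)) ≡ (m + n ∸ K) + (m ∸ j) * (K ∸ j)
vandermonde-exponent {n = n} {j = j} j≤m j≤K K-j≤n with ℕₚ.m≤n⇒∃[o]m+o≡n j≤m | ℕₚ.m≤n⇒∃[o]m+o≡n j≤K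
... | u , refl | v , refl with ℕₚ.m≤n⇒∃[o]m+o≡n (subst (_≤ n) (ℕₚ.m+n∸m≡n j v) K-j≤n)
...   | w , refl = begin
  (j + u ∸ j) * (suc (j + v) ∸ j) + (v + w ∸ (j + v ∸ j))
    ≡⟨ cong₂ _+_ (cong₂ _*_ (ℕₚ.m+n∸m≡n j u) 1+v)
                 (trans (cong (v + w ∸_) (ℕₚ.m+n∸m≡n j v)) (ℕₚ.m+n∸m≡n v w)) ⟩
  u * suc v + w
    ≡⟨ polynomial u v w ⟩
  u + w + u * v
    ≡⟨ cong₂ _+_ u+w (cong₂ _*_ (ℕₚ.m+n∸m≡n j u) (ℕₚ.m+n∸m≡n j v)) ⟨
  (j + u + (v + w) ∸ (j + v)) + (j + u ∸ j) * (j + v ∸ j) ∎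
  where
  open ≡-Reasoning
  1+v : suc (j + v) ∸ j ≡ suc v
  1+v = trans (cong (_∸ j) (sym (ℕₚ.+-suc j v))) (ℕₚ.m+n∸m≡n j (suc v))
  rearrange : ∀ j u v w → j + u + (v + w) ≡ j + v + (u + w)
  rearrange = ℕ-Solver.solve-∀
  u+w : j + u + (v + w) ∸ (j + v) ≡ u + w
  u+w = trans (cong (_∸ (j + v)) (rearrange j u v w)) (ℕₚ.m+n∸m≡n (j + v) (u + w))
  polynomial : ∀ u v w → u * suc v + w ≡ u + w + u * v
  polynomial = ℕ-Solver.solve-∀

module Gaussian (k : ℕ) .{{_ : NonZero k}} where

  qᵏ^_ : ℕ → Series
  qᵏ^ e = qPow (k * e)

  qᵏ^-+ : ∀ e e′ → qᵏ^ e ⊛ qᵏ^ e′ ≈ qᵏ^ (e + e′)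
  qᵏ^-+ e e′ = ≈-trans (qPow-+ (k * e) (k * e′)) (qPow-cong (sym (ℕₚ.*-distribˡ-+ k e e′)))

  qᵏ^-cong : ∀ {e e′} → e ≡ e′ → qᵏ^ e ≈ qᵏ^ e′
  qᵏ^-cong refl = ≈-refl

  qᵏ^-zero : ∀ {e} → e ≡ 0 → qᵏ^ e ≈ one
  qᵏ^-zero refl = qPow-cong (ℕₚ.*-zeroʳ k)

  oneMinusQᵏ-inverse : ∀ m → oneMinusQ (k * suc m) ⊛ invOneMinusQ (k * suc m) ≈ one
  oneMinusQᵏ-inverse m = oneMinusQ-inverse (k * suc m) {{ℕₚ.m*n≢0 k (suc m)}}

  poch-inverse : ∀ m → poch k m ⊛ invPoch k m ≈ one
  poch-inverse zero    = ⊛-identityˡ one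
  poch-inverse (suc m) = begin
    poch k m ⊛ O ⊛ (invPoch k m ⊛ I)
      ≈⟨ solve 4 (λ p o i j → p ∙ o ∙ (i ∙ j) ⊜ p ∙ i ∙ (o ∙ j)) ≈-refl (poch k m) O (invPoch k m) I ⟩
    poch k m ⊛ invPoch k m ⊛ (O ⊛ I)
      ≈⟨ ⊛-cancelʳ (poch k m ⊛ invPoch k m) O I (oneMinusQᵏ-inverse m) ⟩
    poch k m ⊛ invPoch k m
      ≈⟨ poch-inverse m ⟩
    one ∎
    where
    open ≈-Reasoning
    O = oneMinusQ (k * suc m)
    I = invOneMinusQ (k * suc m)

  gauss-+ : ∀ {A} B C → A ≡ B + C → gauss k A B ≈ poch k A ⊛ invPoch k B ⊛ invPoch k C
  gauss-+ B C refl rewrite dec-true (B ≤? B + C) (ℕₚ.m≤m+n B C) | ℕₚ.m+n∸m≡n B C = ≈-refl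

  gauss-< : ∀ {A B} → A < B → gauss k A B ≈ zeroS
  gauss-< {A} {B} A<B rewrite dec-false (B ≤? A) (ℕₚ.<⇒≱ A<B) = ≈-refl

  gauss-congˡ : ∀ {A A′} B → A ≡ A′ → gauss k A B ≈ gauss k A′ B
  gauss-congˡ B refl = ≈-refl

  gauss-congʳ : ∀ A {B B′} → B ≡ B′ → gauss k A B ≈ gauss k A B′
  gauss-congʳ A refl = ≈-refl

  gauss-zero : ∀ A {B} → B ≡ 0 → gauss k A B ≈ one
  gauss-zero A refl = begin
    gauss k A 0                              ≈⟨ gauss-+ 0 A refl ⟩
    poch k A ⊛ one ⊛ invPoch k A             ≈⟨ ⊛-congʳ (invPoch k A) (⊛-identityʳ (poch k A)) ⟩
    poch k A ⊛ invPoch k A                   ≈⟨ poch-inverse A ⟩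
    one                                      ∎
    where open ≈-Reasoning

  gauss-diag : ∀ A → gauss k A A ≈ one
  gauss-diag A = begin
    gauss k A A                              ≈⟨ gauss-+ A 0 (sym (ℕₚ.+-identityʳ A)) ⟩
    poch k A ⊛ invPoch k A ⊛ one             ≈⟨ ⊛-identityʳ _ ⟩
    poch k A ⊛ invPoch k A                   ≈⟨ poch-inverse A ⟩
    one                                      ∎
    where open ≈-Reasoning

  gauss-sym : ∀ {A} B C → A ≡ B + C → gauss k A B ≈ gauss k A C
  gauss-sym {A} B C A≡B+C = begin
    gauss k A B                              ≈⟨ gauss-+ B C A≡B+C ⟩
    poch k A ⊛ invPoch k B ⊛ invPoch k C     ≈⟨ solve 3 (λ p i j → p ∙ i ∙ j ⊜ p ∙ j ∙ i) ≈-refl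
                                                         (poch k A) (invPoch k B) (invPoch k C) ⟩
    poch k A ⊛ invPoch k C ⊛ invPoch k B     ≈⟨ gauss-+ C B (trans A≡B+C (ℕₚ.+-comm B C)) ⟨
    gauss k A C                              ∎
    where open ≈-Reasoning

  -- Rests on  1 - q^{k(K+d+2)} = (1 - q^{k(d+1)}) + q^{k(d+1)} (1 - q^{k(K+1)}).
  gauss-pascal-interior : ∀ K d →
    gauss k (suc (suc K + d)) (suc K) ≈ gauss k (suc K + d) (suc K) ⊕ qᵏ^ (suc d) ⊛ gauss k (suc K + d) K
  gauss-pascal-interior K d = begin
    gauss k (suc N) (suc K)
      ≈⟨ gauss-+ (suc K) (suc d) (cong suc (sym (ℕₚ.+-suc K d))) ⟩
    P ⊛ O ⊛ (iK ⊛ Iₖ) ⊛ (iD ⊛ Iₔ)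
      ≈⟨ ⊛-congʳ (iD ⊛ Iₔ) (⊛-congʳ (iK ⊛ Iₖ) (⊛-congˡ P O-split)) ⟩
    P ⊛ (Oₔ ⊕ x ⊛ Oₖ) ⊛ (iK ⊛ Iₖ) ⊛ (iD ⊛ Iₔ)
      ≈⟨ ⊛-congʳ (iD ⊛ Iₔ) (⊛-congʳ (iK ⊛ Iₖ) (⊛-distribˡ P Oₔ (x ⊛ Oₖ))) ⟩
    (P ⊛ Oₔ ⊕ P ⊛ (x ⊛ Oₖ)) ⊛ (iK ⊛ Iₖ) ⊛ (iD ⊛ Iₔ)
      ≈⟨ ⊛-congʳ (iD ⊛ Iₔ) (⊛-distribʳ (iK ⊛ Iₖ) (P ⊛ Oₔ) (P ⊛ (x ⊛ Oₖ))) ⟩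
    (P ⊛ Oₔ ⊛ (iK ⊛ Iₖ) ⊕ P ⊛ (x ⊛ Oₖ) ⊛ (iK ⊛ Iₖ)) ⊛ (iD ⊛ Iₔ)
      ≈⟨ ⊛-distribʳ (iD ⊛ Iₔ) (P ⊛ Oₔ ⊛ (iK ⊛ Iₖ)) (P ⊛ (x ⊛ Oₖ) ⊛ (iK ⊛ Iₖ)) ⟩
    P ⊛ Oₔ ⊛ (iK ⊛ Iₖ) ⊛ (iD ⊛ Iₔ) ⊕ P ⊛ (x ⊛ Oₖ) ⊛ (iK ⊛ Iₖ) ⊛ (iD ⊛ Iₔ)
      ≈⟨ ⊕-cong (solve 6 (λ p o i I j J → p ∙ o ∙ (i ∙ I) ∙ (j ∙ J) ⊜ p ∙ (i ∙ I) ∙ j ∙ (o ∙ J))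
                         ≈-refl P Oₔ iK Iₖ iD Iₔ)
                (solve 7 (λ p y o i I j J → p ∙ (y ∙ o) ∙ (i ∙ I) ∙ (j ∙ J) ⊜ y ∙ (p ∙ i ∙ (j ∙ J)) ∙ (o ∙ I))
                         ≈-refl P x Oₖ iK Iₖ iD Iₔ) ⟩
    P ⊛ (iK ⊛ Iₖ) ⊛ iD ⊛ (Oₔ ⊛ Iₔ) ⊕ x ⊛ (P ⊛ iK ⊛ (iD ⊛ Iₔ)) ⊛ (Oₖ ⊛ Iₖ)
      ≈⟨ ⊕-cong (⊛-cancelʳ (P ⊛ (iK ⊛ Iₖ) ⊛ iD) Oₔ Iₔ (oneMinusQᵏ-inverse d))
                (⊛-cancelʳ (x ⊛ (P ⊛ iK ⊛ (iD ⊛ Iₔ))) Oₖ Iₖ (oneMinusQᵏ-inverse K)) ⟩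
    P ⊛ (iK ⊛ Iₖ) ⊛ iD ⊕ x ⊛ (P ⊛ iK ⊛ (iD ⊛ Iₔ))
      ≈⟨ ⊕-cong (gauss-+ (suc K) d refl) (⊛-congˡ x (gauss-+ K (suc d) (sym (ℕₚ.+-suc K d)))) ⟨
    gauss k N (suc K) ⊕ x ⊛ gauss k N K ∎
    where
    open ≈-Reasoning
    N = suc K + d
    P = poch k N
    O = oneMinusQ (k * suc N)
    iK = invPoch k K
    iD = invPoch k d
    Oₖ = oneMinusQ (k * suc K)
    Iₖ = invOneMinusQ (k * suc K)
    Oₔ = oneMinusQ (k * suc d)
    Iₔ = invOneMinusQ (k * suc d)
    x = qᵏ^ (suc d)
    O-split : O ≈ Oₔ ⊕ x ⊛ Oₖ
    O-split = subst (λ e → oneMinusQ e ≈ Oₔ ⊕ x ⊛ Oₖ) (exponent k K d) (oneMinusQ-+ (k * suc d) (k * suc K))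
      where
      exponent : ∀ k K d → k * suc d + k * suc K ≡ k * suc (suc K + d)
      exponent = ℕ-Solver.solve-∀

  gauss-pascal : ∀ N K → gauss k (suc N) (suc K) ≈ gauss k N (suc K) ⊕ qᵏ^ (N ∸ K) ⊛ gauss k N K
  gauss-pascal N K with ℕₚ.<-cmp N K
  ... | tri< N<K _ _ = begin
    gauss k (suc N) (suc K)                       ≈⟨ gauss-< (s≤s N<K) ⟩
    zeroS                                         ≈⟨ mk≈ (λ _ → refl) ⟩
    zeroS ⊕ zeroS                                 ≈⟨ ⊕-cong (gauss-< (ℕₚ.m<n⇒m<1+n N<K)) x⊛0≈0 ⟨
    gauss k N (suc K) ⊕ x ⊛ gauss k N K           ∎
    where
    open ≈-Reasoning
    x = qᵏ^ (N ∸ K)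
    x⊛0≈0 : x ⊛ gauss k N K ≈ zeroS
    x⊛0≈0 = ≈-trans (⊛-congˡ x (gauss-< N<K)) (⊛-zeroʳ x)
  ... | tri≈ _ refl _ = begin
    gauss k (suc N) (suc N)                       ≈⟨ gauss-diag (suc N) ⟩
    one                                           ≈⟨ ⊛-identityˡ one ⟨
    one ⊛ one                                     ≈⟨ mk≈ (λ n → ℤₚ.+-identityˡ ((one ⊛ one) n)) ⟨
    zeroS ⊕ one ⊛ one                             ≈⟨ ⊕-cong (gauss-< (ℕₚ.n<1+n N))
                                                              (⊛-cong (qᵏ^-zero (ℕₚ.n∸n≡0 N)) (gauss-diag N)) ⟨
    gauss k N (suc N) ⊕ qᵏ^ (N ∸ N) ⊛ gauss k N N ∎
    where open ≈-Reasoning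
  ... | tri> _ _ K<N with ℕₚ.m≤n⇒∃[o]m+o≡n K<N
  ...   | d , refl = ≈-trans (gauss-pascal-interior K d)
                             (⊕-congˡ (gauss k N (suc K)) (⊛-congʳ (gauss k N K) (qᵏ^-cong N∸K≡1+d)))
    where
    N∸K≡1+d : suc d ≡ N ∸ K
    N∸K≡1+d = sym (trans (cong (_∸ K) (sym (ℕₚ.+-suc K d))) (ℕₚ.m+n∸m≡n K (suc d)))

  monomial-exchange : ∀ e f e′ f′ g h → g ⊛ h ≈ zeroS ⊎ e + f ≡ e′ + f′ →
                      qᵏ^ e ⊛ g ⊛ (qᵏ^ f ⊛ h) ≈ qᵏ^ e′ ⊛ (qᵏ^ f′ ⊛ g ⊛ h)
  monomial-exchange e f e′ f′ g h cases = begin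
    qᵏ^ e ⊛ g ⊛ (qᵏ^ f ⊛ h)
      ≈⟨ solve 4 (λ x g y h → x ∙ g ∙ (y ∙ h) ⊜ x ∙ y ∙ (g ∙ h)) ≈-refl (qᵏ^ e) g (qᵏ^ f) h ⟩
    qᵏ^ e ⊛ qᵏ^ f ⊛ (g ⊛ h)
      ≈⟨ exchange cases ⟩
    qᵏ^ e′ ⊛ qᵏ^ f′ ⊛ (g ⊛ h)
      ≈⟨ solve 4 (λ x g y h → x ∙ (y ∙ g ∙ h) ⊜ x ∙ y ∙ (g ∙ h)) ≈-refl (qᵏ^ e′) g (qᵏ^ f′) h ⟨
    qᵏ^ e′ ⊛ (qᵏ^ f′ ⊛ g ⊛ h) ∎
    where
    open ≈-Reasoning
    exchange : g ⊛ h ≈ zeroS ⊎ e + f ≡ e′ + f′ → qᵏ^ e ⊛ qᵏ^ f ⊛ (g ⊛ h) ≈ qᵏ^ e′ ⊛ qᵏ^ f′ ⊛ (g ⊛ h)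
    exchange (inj₁ gh≈0) = ≈-trans (annihilate (qᵏ^ e ⊛ qᵏ^ f)) (≈-sym (annihilate (qᵏ^ e′ ⊛ qᵏ^ f′)))
      where
      annihilate : ∀ x → x ⊛ (g ⊛ h) ≈ zeroS
      annihilate x = ≈-trans (⊛-congˡ x gh≈0) (⊛-zeroʳ x)
    exchange (inj₂ e+f≡e′+f′) =
      ⊛-congʳ (g ⊛ h) (≈-trans (qᵏ^-+ e f) (≈-trans (qᵏ^-cong e+f≡e′+f′) (≈-sym (qᵏ^-+ e′ f′))))

  vandermondeTerm : ℕ → ℕ → ℕ → ℕ → Series
  vandermondeTerm m n K j = qᵏ^ ((m ∸ j) * (K ∸ j)) ⊛ gauss k m j ⊛ gauss k n (K ∸ j)

  vandermondeTerm-last : ∀ m n K → vandermondeTerm m n K K ≈ gauss k m K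
  vandermondeTerm-last m n K = begin
    qᵏ^ ((m ∸ K) * (K ∸ K)) ⊛ gauss k m K ⊛ gauss k n (K ∸ K)
      ≈⟨ ⊛-cong (⊛-congʳ (gauss k m K) (qᵏ^-zero (trans (cong ((m ∸ K) *_) K∸K≡0) (ℕₚ.*-zeroʳ (m ∸ K)))))
                (gauss-zero n K∸K≡0) ⟩
    one ⊛ gauss k m K ⊛ one
      ≈⟨ ≈-trans (⊛-identityʳ _) (⊛-identityˡ _) ⟩
    gauss k m K ∎
    where
    open ≈-Reasoning
    K∸K≡0 : K ∸ K ≡ 0
    K∸K≡0 = ℕₚ.n∸n≡0 K

  vandermondeTerm-pascal : ∀ m n K j → j ≤ K →
    vandermondeTerm m (suc n) (suc K) j ≈ vandermondeTerm m n (suc K) j ⊕ qᵏ^ (m + n ∸ K) ⊛ vandermondeTerm m n K j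
  vandermondeTerm-pascal m n K j j≤K = begin
    A ⊛ gauss k (suc n) (suc K ∸ j)
      ≈⟨ ⊛-congˡ A (gauss-congʳ (suc n) 1+K∸j) ⟩
    A ⊛ gauss k (suc n) (suc (K ∸ j))
      ≈⟨ ⊛-congˡ A (gauss-pascal n (K ∸ j)) ⟩
    A ⊛ (gauss k n (suc (K ∸ j)) ⊕ qᵏ^ (n ∸ (K ∸ j)) ⊛ gauss k n (K ∸ j))
      ≈⟨ ⊛-distribˡ A (gauss k n (suc (K ∸ j))) (qᵏ^ (n ∸ (K ∸ j)) ⊛ gauss k n (K ∸ j)) ⟩
    A ⊛ gauss k n (suc (K ∸ j)) ⊕ A ⊛ (qᵏ^ (n ∸ (K ∸ j)) ⊛ gauss k n (K ∸ j))
      ≈⟨ ⊕-cong (⊛-congˡ A (gauss-congʳ n (sym 1+K∸j)))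
                (monomial-exchange _ _ (m + n ∸ K) ((m ∸ j) * (K ∸ j)) (gauss k m j) (gauss k n (K ∸ j)) vanishes-or-balanced) ⟩
    vandermondeTerm m n (suc K) j ⊕ qᵏ^ (m + n ∸ K) ⊛ vandermondeTerm m n K j ∎
    where
    open ≈-Reasoning
    A = qᵏ^ ((m ∸ j) * (suc K ∸ j)) ⊛ gauss k m j
    1+K∸j : suc K ∸ j ≡ suc (K ∸ j)
    1+K∸j = ℕₚ.+-∸-assoc 1 j≤K
    vanishes-or-balanced : gauss k m j ⊛ gauss k n (K ∸ j) ≈ zeroS ⊎
      (m ∸ j) * (suc K ∸ j) + (n ∸ (K ∸ j)) ≡ (m + n ∸ K) + (m ∸ j) * (K ∸ j)
    vanishes-or-balanced with j ≤? m | K ∸ j ≤? n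
    ... | no j≰m | _ =
      inj₁ (≈-trans (⊛-congʳ (gauss k n (K ∸ j)) (gauss-< (ℕₚ.≰⇒> j≰m))) (⊛-zeroˡ (gauss k n (K ∸ j))))
    ... | yes _ | no K∸j≰n =
      inj₁ (≈-trans (⊛-congˡ (gauss k m j) (gauss-< (ℕₚ.≰⇒> K∸j≰n))) (⊛-zeroʳ (gauss k m j)))
    ... | yes j≤m | yes K∸j≤n = inj₂ (vandermonde-exponent j≤m j≤K K∸j≤n)

  q-vandermonde : ∀ m n K → gauss k (m + n) K ≈ ∑ K (vandermondeTerm m n K)
  q-vandermonde m zero K = begin
    gauss k (m + 0) K                 ≈⟨ gauss-congˡ K (ℕₚ.+-identityʳ m) ⟩
    gauss k m K                       ≈⟨ vandermondeTerm-last m 0 K ⟨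
    vandermondeTerm m 0 K K           ≈⟨ ∑-single K (vandermondeTerm m 0 K) below ⟨
    ∑ K (vandermondeTerm m 0 K)       ∎
    where
    open ≈-Reasoning
    below : ∀ j → j < K → vandermondeTerm m 0 K j ≈ zeroS
    below j j<K = ≈-trans (⊛-congˡ A (gauss-< (ℕₚ.m<n⇒0<n∸m j<K))) (⊛-zeroʳ A)
      where A = qᵏ^ ((m ∸ j) * (K ∸ j)) ⊛ gauss k m j
  q-vandermonde m (suc n) zero = begin
    gauss k (m + suc n) 0             ≈⟨ gauss-zero (m + suc n) refl ⟩
    one                               ≈⟨ gauss-zero m refl ⟨
    gauss k m 0                       ≈⟨ vandermondeTerm-last m (suc n) 0 ⟨
    ∑ 0 (vandermondeTerm m (suc n) 0) ∎
    where open ≈-Reasoning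
  q-vandermonde m (suc n) (suc K) = begin
    gauss k (m + suc n) (suc K)
      ≈⟨ gauss-congˡ (suc K) (ℕₚ.+-suc m n) ⟩
    gauss k (suc (m + n)) (suc K)
      ≈⟨ gauss-pascal (m + n) K ⟩
    gauss k (m + n) (suc K) ⊕ X ⊛ gauss k (m + n) K
      ≈⟨ ⊕-cong (q-vandermonde m n (suc K)) (⊛-congˡ X (q-vandermonde m n K)) ⟩
    ∑ K T₁ ⊕ T₁ (suc K) ⊕ X ⊛ ∑ K T₀
      ≈⟨ ⊕-congˡ (∑ K T₁ ⊕ T₁ (suc K)) (⊛-∑ K X T₀) ⟩
    ∑ K T₁ ⊕ T₁ (suc K) ⊕ ∑ K (λ j → X ⊛ T₀ j)
      ≈⟨ ⊕-swapʳ (∑ K T₁) (T₁ (suc K)) (∑ K (λ j → X ⊛ T₀ j)) ⟩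
    ∑ K T₁ ⊕ ∑ K (λ j → X ⊛ T₀ j) ⊕ T₁ (suc K)
      ≈⟨ ⊕-congʳ (T₁ (suc K)) (∑-⊕ K T₁ (λ j → X ⊛ T₀ j)) ⟨
    ∑ K (λ j → T₁ j ⊕ X ⊛ T₀ j) ⊕ T₁ (suc K)
      ≈⟨ ⊕-cong (∑-cong K λ j j≤K → vandermondeTerm-pascal m n K j j≤K)
                (≈-trans (vandermondeTerm-last m (suc n) (suc K)) (≈-sym (vandermondeTerm-last m n (suc K)))) ⟨
    ∑ K T₂ ⊕ T₂ (suc K) ∎
    where
    open ≈-Reasoning
    X = qᵏ^ (m + n ∸ K)
    T₂ = vandermondeTerm m (suc n) (suc K)
    T₁ = vandermondeTerm m n (suc K)
    T₀ = vandermondeTerm m n K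

  ∑-gauss-squares : ∀ r s → ∑ s (λ h → qᵏ^ (h * h) ⊛ gauss k s h ⊛ gauss k r h) ≈ gauss k (s + r) s
  ∑-gauss-squares r s = ≈-sym (begin
    gauss k (s + r) s                                  ≈⟨ q-vandermonde s r s ⟩
    ∑ s (vandermondeTerm s r s)                        ≈⟨ ∑-reverse s (vandermondeTerm s r s) ⟩
    ∑ s (λ h → vandermondeTerm s r s (s ∸ h))          ≈⟨ ∑-cong s reindex ⟩
    ∑ s (λ h → qᵏ^ (h * h) ⊛ gauss k s h ⊛ gauss k r h) ∎)
    where
    open ≈-Reasoning
    reindex : ∀ h → h ≤ s → vandermondeTerm s r s (s ∸ h) ≈ qᵏ^ (h * h) ⊛ gauss k s h ⊛ gauss k r h
    reindex h h≤s = ⊛-cong (⊛-cong (qᵏ^-cong (cong₂ _*_ s∸[s∸h]≡h s∸[s∸h]≡h))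
                                   (gauss-sym (s ∸ h) h (sym (ℕₚ.m∸n+n≡m h≤s))))
                           (gauss-congʳ r s∸[s∸h]≡h)
      where
      s∸[s∸h]≡h : s ∸ (s ∸ h) ≡ h
      s∸[s∸h]≡h = ℕₚ.m∸[m∸n]≡n h≤s

≤ᵇ-true : ∀ {m n} → m ≤ n → (m ≤ᵇ n) ≡ true
≤ᵇ-true {m} {n} = dec-true (m ≤? n)

≡ᵇ-refl : ∀ n → (n ≡ᵇ n) ≡ true
≡ᵇ-refl n = dec-true (n ≟ n) refl

≤ᵇ-true⁻¹ : ∀ m n → (m ≤ᵇ n) ≡ true → m ≤ n
≤ᵇ-true⁻¹ m n m≤ᵇn = ℕₚ.≤ᵇ⇒≤ m n (subst T (sym m≤ᵇn) _)

≡ᵇ-true⁻¹ : ∀ m n → (m ≡ᵇ n) ≡ true → m ≡ n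
≡ᵇ-true⁻¹ m n m≡ᵇn = ℕₚ.≡ᵇ⇒≡ m n (subst T (sym m≡ᵇn) _)

module CellSeries (k a b : ℕ) .{{_ : NonZero k}} (a≤b : a ≤ b) where
  open Gaussian k

  -- q^{ra+sb} / ((q^k;q^k)_r (q^k;q^k)_s): each a-part is a plus a multiple of k, each b-part likewise.
  cellSeries : ℕ → ℕ → Series
  cellSeries r s = qPow (r * a + s * b) ⊛ invPoch k r ⊛ invPoch k s

  termCoeff-off : ∀ r s n m h i → ¬ (m ≡ r + s × h + i ≡ s) → termCoeff k a b m h i r s n ≡ + 0
  termCoeff-off r s n m h i off
    with h + i ≤ᵇ m in h+i≤m | m ∸ (h + i) ≡ᵇ r in m∸[h+i]≡r | h + i ≡ᵇ s in h+i≡s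
  ... | true  | true  | true  = contradiction (m≡r+s , h+i≡s′) off
    where
    h+i≡s′ : h + i ≡ s
    h+i≡s′ = ≡ᵇ-true⁻¹ (h + i) s h+i≡s
    m≡r+s : m ≡ r + s
    m≡r+s = trans (sym (ℕₚ.m∸n+n≡m (≤ᵇ-true⁻¹ (h + i) m h+i≤m)))
                  (cong₂ _+_ (≡ᵇ-true⁻¹ (m ∸ (h + i)) r m∸[h+i]≡r) h+i≡s′)
  ... | true  | true  | false = refl
  ... | true  | false | _     = refl
  ... | false | _     | _     = refl

  termCoeff-on : ∀ r s n h → h ≤ s → termCoeff k a b (r + s) h (s ∸ h) r s n ≡ termQ k a b (r + s) h (s ∸ h) n
  termCoeff-on r s n h h≤s
    rewrite ℕₚ.m+[n∸m]≡n h≤s | ≤ᵇ-true (ℕₚ.m≤n+m s r) | ℕₚ.m+n∸n≡m r s | ≡ᵇ-refl r | ≡ᵇ-refl s = refl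

  rhsCoeff-diagonal : ∀ r s n → rhsCoeff k a b r s n ≡ ∑ s (λ h → termQ k a b (r + s) h (s ∸ h)) n
  rhsCoeff-diagonal r s n =
    trans (sumTo-single (r + s) (r + s) _ ℕₚ.≤-refl off-diagonal) (sumTo-cong s diagonal)
    where
    off-diagonal : ∀ m → m ≤ r + s → m ≢ r + s → sumTo s (λ h → sumTo s λ i → termCoeff k a b m h i r s n) ≡ + 0
    off-diagonal m _ m≢r+s = sumTo-≡0 s _ λ h _ → sumTo-≡0 s _ λ i _ → termCoeff-off r s n m h i (m≢r+s ∘ proj₁)
    diagonal : ∀ h → h ≤ s → sumTo s (λ i → termCoeff k a b (r + s) h i r s n) ≡ termQ k a b (r + s) h (s ∸ h) n
    diagonal h h≤s = trans (sumTo-single s (s ∸ h) _ (ℕₚ.m∸n≤m s h) off) (termCoeff-on r s n h h≤s)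
      where
      off : ∀ i → i ≤ s → i ≢ s ∸ h → termCoeff k a b (r + s) h i r s n ≡ + 0
      off i _ i≢s∸h = termCoeff-off r s n (r + s) h i λ (_ , h+i≡s) →
        i≢s∸h (trans (sym (ℕₚ.m+n∸m≡n h i)) (cong (_∸ h) h+i≡s))

  termQ-factor : ∀ r s h → h ≤ s →
    termQ k a b (r + s) h (s ∸ h) ≈
    qPow ((r + s) * a + (b ∸ a) * s) ⊛ invPoch k (r + s) ⊛ (qᵏ^ (h * h) ⊛ gauss k s h ⊛ gauss k r h)
  termQ-factor r s h h≤s = begin
    qPow ((r + s) * a + k * (h * h) + (b ∸ a) * (h + (s ∸ h))) ⊛ iP ⊛ gauss k (h + (s ∸ h)) h
      ⊛ gauss k (r + s ∸ (h + (s ∸ h))) h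
      ≈⟨ ⊛-cong (⊛-cong (⊛-congʳ iP (qPow-cong exponent)) (gauss-congˡ h h+[s∸h]≡s)) (gauss-congˡ h r+s∸s≡r) ⟩
    qPow (E + k * (h * h)) ⊛ iP ⊛ gauss k s h ⊛ gauss k r h
      ≈⟨ ⊛-congʳ (gauss k r h) (⊛-congʳ (gauss k s h) (⊛-congʳ iP (qPow-+ E (k * (h * h))))) ⟨
    qPow E ⊛ qᵏ^ (h * h) ⊛ iP ⊛ gauss k s h ⊛ gauss k r h
      ≈⟨ solve 5 (λ e x i g g′ → e ∙ x ∙ i ∙ g ∙ g′ ⊜ e ∙ i ∙ (x ∙ g ∙ g′)) ≈-refl
                 (qPow E) (qᵏ^ (h * h)) iP (gauss k s h) (gauss k r h) ⟩
    qPow E ⊛ iP ⊛ (qᵏ^ (h * h) ⊛ gauss k s h ⊛ gauss k r h) ∎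
    where
    open ≈-Reasoning
    E = (r + s) * a + (b ∸ a) * s
    iP = invPoch k (r + s)
    h+[s∸h]≡s : h + (s ∸ h) ≡ s
    h+[s∸h]≡s = ℕₚ.m+[n∸m]≡n h≤s
    r+s∸s≡r : r + s ∸ (h + (s ∸ h)) ≡ r
    r+s∸s≡r = trans (cong (r + s ∸_) h+[s∸h]≡s) (ℕₚ.m+n∸n≡m r s)
    exponent : (r + s) * a + k * (h * h) + (b ∸ a) * (h + (s ∸ h)) ≡ E + k * (h * h)
    exponent rewrite h+[s∸h]≡s = swap ((r + s) * a) (k * (h * h)) ((b ∸ a) * s)
      where
      swap : ∀ x y z → x + y + z ≡ x + z + y
      swap = ℕ-Solver.solve-∀

  rhsCoeff≡cellSeries : ∀ r s n → rhsCoeff k a b r s n ≡ cellSeries r s n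
  rhsCoeff≡cellSeries r s n = trans (rhsCoeff-diagonal r s n) (at summed n)
    where
    open ≈-Reasoning
    E = (r + s) * a + (b ∸ a) * s
    C = qPow E ⊛ invPoch k (r + s)
    P = poch k (r + s)
    exponent : E ≡ r * a + s * b
    exponent with ℕₚ.m≤n⇒∃[o]m+o≡n a≤b
    ... | d , refl rewrite ℕₚ.m+n∸m≡n a d = polynomial r s a d
      where
      polynomial : ∀ r s a d → (r + s) * a + d * s ≡ r * a + s * (a + d)
      polynomial = ℕ-Solver.solve-∀
    summed : ∑ s (λ h → termQ k a b (r + s) h (s ∸ h)) ≈ cellSeries r s
    summed = begin
      ∑ s (λ h → termQ k a b (r + s) h (s ∸ h))
        ≈⟨ ∑-cong s (termQ-factor r s) ⟩
      ∑ s (λ h → C ⊛ (qᵏ^ (h * h) ⊛ gauss k s h ⊛ gauss k r h))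
        ≈⟨ ⊛-∑ s C (λ h → qᵏ^ (h * h) ⊛ gauss k s h ⊛ gauss k r h) ⟨
      C ⊛ ∑ s (λ h → qᵏ^ (h * h) ⊛ gauss k s h ⊛ gauss k r h)
        ≈⟨ ⊛-congˡ C (∑-gauss-squares r s) ⟩
      C ⊛ gauss k (s + r) s
        ≈⟨ ⊛-congˡ C (≈-trans (gauss-congˡ s (ℕₚ.+-comm s r)) (gauss-+ s r (ℕₚ.+-comm r s))) ⟩
      C ⊛ (P ⊛ invPoch k s ⊛ invPoch k r)
        ≈⟨ solve 5 (λ q i p j l → q ∙ i ∙ (p ∙ j ∙ l) ⊜ q ∙ l ∙ j ∙ (p ∙ i)) ≈-refl
                   (qPow E) (invPoch k (r + s)) P (invPoch k s) (invPoch k r) ⟩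
      qPow E ⊛ invPoch k r ⊛ invPoch k s ⊛ (P ⊛ invPoch k (r + s))
        ≈⟨ ⊛-cancelʳ (qPow E ⊛ invPoch k r ⊛ invPoch k s) P (invPoch k (r + s)) (poch-inverse (r + s)) ⟩
      qPow E ⊛ invPoch k r ⊛ invPoch k s
        ≈⟨ ⊛-congʳ (invPoch k s) (⊛-congʳ (invPoch k r) (qPow-cong exponent)) ⟩
      cellSeries r s ∎

  cellSeries-sucˡ : ∀ r s → cellSeries (suc r) s ≈ qPow a ⊛ cellSeries r s ⊕ qᵏ^ (suc r) ⊛ cellSeries (suc r) s
  cellSeries-sucˡ r s = begin
    qPow E ⊛ (invPoch k r ⊛ I) ⊛ invPoch k s
      ≈⟨ solve 4 (λ x i I j → x ∙ (i ∙ I) ∙ j ⊜ x ∙ i ∙ j ∙ I) ≈-refl (qPow E) (invPoch k r) I (invPoch k s) ⟩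
    Y ⊛ I
      ≈⟨ ⊛-invOneMinusQ-unfold (k * suc r) {{ℕₚ.m*n≢0 k (suc r)}} Y ⟩
    Y ⊕ qᵏ^ (suc r) ⊛ (Y ⊛ I)
      ≈⟨ ⊕-cong Y≈ (⊛-congˡ (qᵏ^ (suc r)) (solve 4 (λ x i j I → x ∙ i ∙ j ∙ I ⊜ x ∙ (i ∙ I) ∙ j) ≈-refl
                                                     (qPow E) (invPoch k r) (invPoch k s) I)) ⟩
    qPow a ⊛ cellSeries r s ⊕ qᵏ^ (suc r) ⊛ cellSeries (suc r) s ∎
    where
    open ≈-Reasoning
    E = suc r * a + s * b
    I = invOneMinusQ (k * suc r)
    Y = qPow E ⊛ invPoch k r ⊛ invPoch k s
    Y≈ : Y ≈ qPow a ⊛ cellSeries r s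
    Y≈ = ≈-trans (⊛-congʳ (invPoch k s) (⊛-congʳ (invPoch k r) (qPow-cong (ℕₚ.+-assoc a (r * a) (s * b)))))
                 (qPow-⊛-split a (r * a + s * b) (invPoch k r) (invPoch k s))

  cellSeries-sucʳ : ∀ r s → cellSeries r (suc s) ≈ qPow b ⊛ cellSeries r s ⊕ qᵏ^ (suc s) ⊛ cellSeries r (suc s)
  cellSeries-sucʳ r s = begin
    qPow E ⊛ invPoch k r ⊛ (invPoch k s ⊛ I)
      ≈⟨ ⊛-assoc (qPow E ⊛ invPoch k r) (invPoch k s) I ⟨
    Y ⊛ I
      ≈⟨ ⊛-invOneMinusQ-unfold (k * suc s) {{ℕₚ.m*n≢0 k (suc s)}} Y ⟩
    Y ⊕ qᵏ^ (suc s) ⊛ (Y ⊛ I)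
      ≈⟨ ⊕-cong Y≈ (⊛-congˡ (qᵏ^ (suc s)) (⊛-assoc (qPow E ⊛ invPoch k r) (invPoch k s) I)) ⟩
    qPow b ⊛ cellSeries r s ⊕ qᵏ^ (suc s) ⊛ cellSeries r (suc s) ∎
    where
    open ≈-Reasoning
    E = r * a + suc s * b
    I = invOneMinusQ (k * suc s)
    Y = qPow E ⊛ invPoch k r ⊛ invPoch k s
    Y≈ : Y ≈ qPow b ⊛ cellSeries r s
    Y≈ = ≈-trans (⊛-congʳ (invPoch k s) (⊛-congʳ (invPoch k r) (qPow-cong (shuffle (r * a) b (s * b)))))
                 (qPow-⊛-split b (r * a + s * b) (invPoch k r) (invPoch k s))
      where
      shuffle : ∀ x y z → x + (y + z) ≡ y + (x + z)
      shuffle = ℕ-Solver.solve-∀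

  -- Counts the cells with no part equal to a, whose a-parts are all at least a + k.
  cellSeries≢a : ℕ → ℕ → Series
  cellSeries≢a r s = qᵏ^ r ⊛ cellSeries r s

  cellSeries-zeroˡ : ∀ s → cellSeries 0 s ≈ cellSeries≢a 0 s
  cellSeries-zeroˡ s = ≈-sym (≈-trans (⊛-congʳ (cellSeries 0 s) (qᵏ^-zero refl)) (⊛-identityˡ (cellSeries 0 s)))

  cellSeries≢a-zero : cellSeries≢a 0 0 ≈ one
  cellSeries≢a-zero = ≈-trans (≈-sym (cellSeries-zeroˡ 0)) (≈-trans (⊛-identityʳ (qPow 0 ⊛ one)) (⊛-identityʳ (qPow 0)))

  cellSeries≢a-sucʳ : ∀ r s → cellSeries≢a r (suc s) ≈ qPow b ⊛ cellSeries≢a r s ⊕ qᵏ^ (r + suc s) ⊛ cellSeries r (suc s)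
  cellSeries≢a-sucʳ r s = begin
    qᵏ^ r ⊛ cellSeries r (suc s)
      ≈⟨ ⊛-congˡ (qᵏ^ r) (cellSeries-sucʳ r s) ⟩
    qᵏ^ r ⊛ (qPow b ⊛ cellSeries r s ⊕ qᵏ^ (suc s) ⊛ cellSeries r (suc s))
      ≈⟨ ⊛-distribˡ (qᵏ^ r) (qPow b ⊛ cellSeries r s) (qᵏ^ (suc s) ⊛ cellSeries r (suc s)) ⟩
    qᵏ^ r ⊛ (qPow b ⊛ cellSeries r s) ⊕ qᵏ^ r ⊛ (qᵏ^ (suc s) ⊛ cellSeries r (suc s))
      ≈⟨ ⊕-cong (solve 3 (λ x y c → x ∙ (y ∙ c) ⊜ y ∙ (x ∙ c)) ≈-refl (qPow b) (qᵏ^ r) (cellSeries r s))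
                (≈-trans (⊛-congʳ (cellSeries r (suc s)) (≈-sym (qᵏ^-+ r (suc s))))
                         (⊛-assoc (qᵏ^ r) (qᵏ^ (suc s)) (cellSeries r (suc s)))) ⟨
    qPow b ⊛ cellSeries≢a r s ⊕ qᵏ^ (r + suc s) ⊛ cellSeries r (suc s) ∎
    where open ≈-Reasoning

-- Sorted cells and their enumeration

All-reverse : ∀ {P : ℕ → Set} {xs} → All P xs → All P (reverse xs)
All-reverse {xs = xs} = ↭ₚ.All-resp-↭ (↭.↭-sym (↭ₚ.↭-reverse xs))

sum-reverse : ∀ xs → sum (reverse xs) ≡ sum xs
sum-reverse xs = ListActionₚ.sum-↭ (↭ₚ.↭-reverse xs)

AllPairs-reverse : ∀ {R : ℕ → ℕ → Set} {xs} → AllPairs R xs → AllPairs (flip R) (reverse xs)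
AllPairs-reverse [] = []
AllPairs-reverse {R} {x ∷ xs} (Rx ∷ Rxs) = subst (AllPairs (flip R)) (sym (List.unfold-reverse x xs))
  (AllPairs.++⁺ (AllPairs-reverse Rxs) ([] ∷ []) (All.map (_∷ []) (All-reverse Rx)))

Linked-reverse : ∀ {R : ℕ → ℕ → Set} → Transitive R → ∀ {xs} → Linked R xs → Linked (flip R) (reverse xs)
Linked-reverse trans = Linkedₚ.AllPairs⇒Linked ∘ AllPairs-reverse ∘ Linkedₚ.Linked⇒AllPairs trans

module Enumeration (k a b : ℕ) .{{_ : NonZero k}} (1≤a : 1 ≤ a) (a<b : a < b) (b≤k : b ≤ k) where

  HasResidue : ℕ → Set
  HasResidue y = (y % k ≡ a % k) ⊎ (y % k ≡ b % k)

  -- The partitions of the theorem listed in increasing order, so that they grow by a smallest part.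
  record SortedCell (n r s : ℕ) (ρ : List ℕ) : Set where
    field
      ascending : Linked _≤_ ρ
      positive  : All (1 ≤_) ρ
      residues  : All HasResidue ρ
      sum≡      : sum ρ ≡ n
      ℓa≡       : ℓ k a ρ ≡ r
      ℓb≡       : ℓ k b ρ ≡ s
  open SortedCell

  WithoutA : List ℕ → Set
  WithoutA = All (_≢ a)

  1≤b : 1 ≤ b
  1≤b = ℕₚ.≤-trans 1≤a (ℕₚ.<⇒≤ a<b)

  a<k : a < k
  a<k = ℕₚ.<-≤-trans a<b b≤k

  a%k≡a : a % k ≡ a
  a%k≡a = DivMod.m<n⇒m%n≡m a<k

  b%k≡0⇒b≡k : b % k ≡ 0 → b ≡ k
  b%k≡0⇒b≡k b%k≡0 with ℕₚ.m≤n⇒m<n∨m≡n b≤k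
  ... | inj₁ b<k = contradiction (trans (sym (DivMod.m<n⇒m%n≡m b<k)) b%k≡0) (ℕₚ.>⇒≢ 1≤b)
  ... | inj₂ b≡k = b≡k

  a%k≢b%k : a % k ≢ b % k
  a%k≢b%k a%k≡b%k with ℕₚ.m≤n⇒m<n∨m≡n b≤k
  ... | inj₁ b<k  = ℕₚ.<⇒≢ a<b (trans (sym a%k≡a) (trans a%k≡b%k (DivMod.m<n⇒m%n≡m b<k)))
  ... | inj₂ refl = ℕₚ.>⇒≢ 1≤a (trans (sym a%k≡a) (trans a%k≡b%k (DivMod.n%n≡0 k)))

  -- a < b ≤ k are the two smallest positive numbers with these residues; every other one exceeds k.
  part-cases : ∀ {y} → 1 ≤ y → HasResidue y → y ≡ a ⊎ y ≡ b ⊎ k < y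
  part-cases {y} 1≤y res with ℕₚ.<-cmp y k
  ... | tri> _ _ k<y = inj₂ (inj₂ k<y)
  ... | tri≈ _ refl _ = case res
    where
    case : HasResidue k → k ≡ a ⊎ k ≡ b ⊎ k < k
    case (inj₁ k%k≡a%k) = contradiction (trans (sym (DivMod.n%n≡0 k)) (trans k%k≡a%k a%k≡a)) (ℕₚ.>⇒≢ 1≤a ∘ sym)
    case (inj₂ k%k≡b%k) = inj₂ (inj₁ (sym (b%k≡0⇒b≡k (trans (sym k%k≡b%k) (DivMod.n%n≡0 k)))))
  ... | tri< y<k _ _ = case res
    where
    y%k≡y : y % k ≡ y
    y%k≡y = DivMod.m<n⇒m%n≡m y<k
    case : HasResidue y → y ≡ a ⊎ y ≡ b ⊎ k < y
    case (inj₁ y%k≡a%k) = inj₁ (trans (sym y%k≡y) (trans y%k≡a%k a%k≡a))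
    case (inj₂ y%k≡b%k) with ℕₚ.m≤n⇒m<n∨m≡n b≤k
    ... | inj₁ b<k  = inj₂ (inj₁ (trans (sym y%k≡y) (trans y%k≡b%k (DivMod.m<n⇒m%n≡m b<k))))
    ... | inj₂ refl = contradiction (trans (sym y%k≡y) (trans y%k≡b%k (DivMod.n%n≡0 k))) (ℕₚ.>⇒≢ 1≤y)

  a≤part : ∀ {y} → 1 ≤ y → HasResidue y → a ≤ y
  a≤part 1≤y res with part-cases 1≤y res
  ... | inj₁ refl         = ℕₚ.≤-refl
  ... | inj₂ (inj₁ refl)  = ℕₚ.<⇒≤ a<b
  ... | inj₂ (inj₂ k<y)   = ℕₚ.<⇒≤ (ℕₚ.<-trans a<k k<y)

  b≤part : ∀ {y} → 1 ≤ y → HasResidue y → y ≢ a → b ≤ y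
  b≤part 1≤y res y≢a with part-cases 1≤y res
  ... | inj₁ y≡a          = contradiction y≡a y≢a
  ... | inj₂ (inj₁ refl)  = ℕₚ.≤-refl
  ... | inj₂ (inj₂ k<y)   = ℕₚ.≤-trans b≤k (ℕₚ.<⇒≤ k<y)

  raise : List ℕ → List ℕ
  raise = map (_+_ k)

  k+-residue : ∀ y → (k + y) % k ≡ y % k
  k+-residue y = trans (cong (_% k) (ℕₚ.+-comm k y)) (DivMod.[m+n]%n≡m%n y k)

  ℓ-hit : ∀ c y ρ → y % k ≡ c % k → ℓ k c (y ∷ ρ) ≡ suc (ℓ k c ρ)
  ℓ-hit c y ρ hit = cong length (List.filter-accept (λ x → x % k ≟ c % k) hit)

  ℓ-miss : ∀ c y ρ → y % k ≢ c % k → ℓ k c (y ∷ ρ) ≡ ℓ k c ρ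
  ℓ-miss c y ρ miss = cong length (List.filter-reject (λ x → x % k ≟ c % k) miss)

  ℓ-raise : ∀ c ρ → ℓ k c (raise ρ) ≡ ℓ k c ρ
  ℓ-raise c [] = refl
  ℓ-raise c (y ∷ ρ) = by-residue (y % k ≟ c % k)
    where
    by-residue : Dec (y % k ≡ c % k) → ℓ k c (raise (y ∷ ρ)) ≡ ℓ k c (y ∷ ρ)
    by-residue (yes hit) = begin
      ℓ k c (k + y ∷ raise ρ)   ≡⟨ ℓ-hit c (k + y) (raise ρ) (trans (k+-residue y) hit) ⟩
      suc (ℓ k c (raise ρ))     ≡⟨ cong suc (ℓ-raise c ρ) ⟩
      suc (ℓ k c ρ)             ≡⟨ ℓ-hit c y ρ hit ⟨
      ℓ k c (y ∷ ρ)             ∎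
      where open ≡-Reasoning
    by-residue (no miss) = begin
      ℓ k c (k + y ∷ raise ρ)   ≡⟨ ℓ-miss c (k + y) (raise ρ) (miss ∘ trans (sym (k+-residue y))) ⟩
      ℓ k c (raise ρ)           ≡⟨ ℓ-raise c ρ ⟩
      ℓ k c ρ                   ≡⟨ ℓ-miss c y ρ miss ⟨
      ℓ k c (y ∷ ρ)             ∎
      where open ≡-Reasoning

  length≡ℓa+ℓb : ∀ {ρ} → All HasResidue ρ → length ρ ≡ ℓ k a ρ + ℓ k b ρ
  length≡ℓa+ℓb [] = refl
  length≡ℓa+ℓb {y ∷ ρ} (inj₁ y≡a ∷ res)
    rewrite ℓ-hit a y ρ y≡a | ℓ-miss b y ρ (a%k≢b%k ∘ trans (sym y≡a)) = cong suc (length≡ℓa+ℓb res)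
  length≡ℓa+ℓb {y ∷ ρ} (inj₂ y≡b ∷ res)
    rewrite ℓ-miss a y ρ (λ y≡a → a%k≢b%k (trans (sym y≡a) y≡b)) | ℓ-hit b y ρ y≡b =
    trans (cong suc (length≡ℓa+ℓb res)) (sym (ℕₚ.+-suc (ℓ k a ρ) (ℓ k b ρ)))

  sum-raise : ∀ ρ → sum (raise ρ) ≡ k * length ρ + sum ρ
  sum-raise []      = sym (cong (_+ 0) (ℕₚ.*-zeroʳ k))
  sum-raise (y ∷ ρ) = trans (cong (λ t → k + y + t) (sum-raise ρ)) (regroup k y (length ρ) (sum ρ))
    where
    regroup : ∀ k y l t → k + y + (k * l + t) ≡ k * suc l + (y + t)
    regroup = ℕ-Solver.solve-∀

  Linked-∷ : ∀ {y ρ} → All (y ≤_) ρ → Linked _≤_ ρ → Linked _≤_ (y ∷ ρ)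
  Linked-∷ []          []  = [-]
  Linked-∷ (y≤z ∷ _)   ρ↑  = y≤z ∷ ρ↑

  parts≥a : ∀ {ρ} → All (1 ≤_) ρ → All HasResidue ρ → All (a ≤_) ρ
  parts≥a []          []           = []
  parts≥a (1≤y ∷ pos) (res ∷ ress) = a≤part 1≤y res ∷ parts≥a pos ress

  parts≥b : ∀ {ρ} → All (1 ≤_) ρ → All HasResidue ρ → WithoutA ρ → All (b ≤_) ρ
  parts≥b []          []           []           = []
  parts≥b (1≤y ∷ pos) (res ∷ ress) (y≢a ∷ ≢as) = b≤part 1≤y res y≢a ∷ parts≥b pos ress ≢as

  []-cell : SortedCell 0 0 0 []
  []-cell = record { ascending = [] ; positive = [] ; residues = [] ; sum≡ = refl ; ℓa≡ = refl ; ℓb≡ = refl }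

  a∷-cell : ∀ {n r s ρ} → SortedCell n r s ρ → SortedCell (a + n) (suc r) s (a ∷ ρ)
  a∷-cell {ρ = ρ} c = record
    { ascending = Linked-∷ (parts≥a (positive c) (residues c)) (ascending c)
    ; positive  = 1≤a ∷ positive c
    ; residues  = inj₁ refl ∷ residues c
    ; sum≡      = cong (_+_ a) (sum≡ c)
    ; ℓa≡       = trans (ℓ-hit a a ρ refl) (cong suc (ℓa≡ c))
    ; ℓb≡       = trans (ℓ-miss b a ρ a%k≢b%k) (ℓb≡ c)
    }

  b∷-cell : ∀ {n r s ρ} → SortedCell n r s ρ → WithoutA ρ → SortedCell (b + n) r (suc s) (b ∷ ρ)
  b∷-cell {ρ = ρ} c ≢as = record
    { ascending = Linked-∷ (parts≥b (positive c) (residues c) ≢as) (ascending c)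
    ; positive  = 1≤b ∷ positive c
    ; residues  = inj₂ refl ∷ residues c
    ; sum≡      = cong (_+_ b) (sum≡ c)
    ; ℓa≡       = trans (ℓ-miss a b ρ (a%k≢b%k ∘ sym)) (ℓa≡ c)
    ; ℓb≡       = trans (ℓ-hit b b ρ refl) (cong suc (ℓb≡ c))
    }

  raise-cell : ∀ {n r s ρ} → SortedCell n r s ρ → SortedCell (k * (r + s) + n) r s (raise ρ)
  raise-cell {n} {r} {s} {ρ} c = record
    { ascending = Linkedₚ.map⁺ (Linked.map (ℕₚ.+-monoʳ-≤ k) (ascending c))
    ; positive  = Allₚ.map⁺ (All.map (λ 1≤y → ℕₚ.≤-trans 1≤y (ℕₚ.m≤n+m _ k)) (positive c))
    ; residues  = Allₚ.map⁺ (All.map k+-residues (residues c))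
    ; sum≡      = begin
        sum (raise ρ)                     ≡⟨ sum-raise ρ ⟩
        k * length ρ + sum ρ              ≡⟨ cong₂ (λ l t → k * l + t) (length≡ℓa+ℓb (residues c)) (sum≡ c) ⟩
        k * (ℓ k a ρ + ℓ k b ρ) + n       ≡⟨ cong (λ l → k * l + n) (cong₂ _+_ (ℓa≡ c) (ℓb≡ c)) ⟩
        k * (r + s) + n                   ∎
    ; ℓa≡       = trans (ℓ-raise a ρ) (ℓa≡ c)
    ; ℓb≡       = trans (ℓ-raise b ρ) (ℓb≡ c)
    }
    where
    open ≡-Reasoning
    k+-residues : ∀ {y} → HasResidue y → HasResidue (k + y)
    k+-residues {y} (inj₁ y≡a) = inj₁ (trans (k+-residue y) y≡a)
    k+-residues {y} (inj₂ y≡b) = inj₂ (trans (k+-residue y) y≡b)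

  raise-WithoutA : ∀ ρ → WithoutA (raise ρ)
  raise-WithoutA ρ = Allₚ.map⁺ (All.tabulate λ {y} _ k+y≡a → ℕₚ.<⇒≱ a<k (subst (k ≤_) k+y≡a (ℕₚ.m≤m+n k y)))

  sum-∷⁻ : ∀ y ρ {n} → sum (y ∷ ρ) ≡ n → y ≤ n × sum ρ ≡ n ∸ y
  sum-∷⁻ y ρ refl = ℕₚ.m≤m+n y (sum ρ) , sym (ℕₚ.m+n∸m≡n y (sum ρ))

  a∷-cell⁻ : ∀ {n r s ρ} → SortedCell n r s (a ∷ ρ) →
             a ≤ n × r ≡ suc (ℓ k a ρ) × SortedCell (n ∸ a) (ℓ k a ρ) s ρ
  a∷-cell⁻ {ρ = ρ} c = proj₁ (sum-∷⁻ a ρ (sum≡ c)) , trans (sym (ℓa≡ c)) (ℓ-hit a a ρ refl) , record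
    { ascending = Linked.tail (ascending c)
    ; positive  = All.tail (positive c)
    ; residues  = All.tail (residues c)
    ; sum≡      = proj₂ (sum-∷⁻ a ρ (sum≡ c))
    ; ℓa≡       = refl
    ; ℓb≡       = trans (sym (ℓ-miss b a ρ a%k≢b%k)) (ℓb≡ c)
    }

  b∷-cell⁻ : ∀ {n r s ρ} → SortedCell n r s (b ∷ ρ) →
             b ≤ n × s ≡ suc (ℓ k b ρ) × SortedCell (n ∸ b) r (ℓ k b ρ) ρ
  b∷-cell⁻ {ρ = ρ} c = proj₁ (sum-∷⁻ b ρ (sum≡ c)) , trans (sym (ℓb≡ c)) (ℓ-hit b b ρ refl) , record
    { ascending = Linked.tail (ascending c)
    ; positive  = All.tail (positive c)
    ; residues  = All.tail (residues c)
    ; sum≡      = proj₂ (sum-∷⁻ b ρ (sum≡ c))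
    ; ℓa≡       = trans (sym (ℓ-miss a b ρ (a%k≢b%k ∘ sym))) (ℓa≡ c)
    ; ℓb≡       = refl
    }

  raise-cell⁻ : ∀ {n r s ρ} → All (1 ≤_) ρ → SortedCell n r s (raise ρ) →
                k * (r + s) ≤ n × SortedCell (n ∸ k * (r + s)) r s ρ
  raise-cell⁻ {n} {r} {s} {ρ} pos c = subst (k * (r + s) ≤_) sum≡n (ℕₚ.m≤m+n _ (sum ρ)) , record
    { ascending = Linked.map (ℕₚ.+-cancelˡ-≤ k _ _) (Linkedₚ.map⁻ (ascending c))
    ; positive  = pos
    ; residues  = All.map k+-residues⁻ (Allₚ.map⁻ (residues c))
    ; sum≡      = trans (sym (ℕₚ.m+n∸m≡n (k * (r + s)) (sum ρ))) (cong (_∸ k * (r + s)) sum≡n)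
    ; ℓa≡       = trans (sym (ℓ-raise a ρ)) (ℓa≡ c)
    ; ℓb≡       = trans (sym (ℓ-raise b ρ)) (ℓb≡ c)
    }
    where
    open ≡-Reasoning
    k+-residues⁻ : ∀ {y} → HasResidue (k + y) → HasResidue y
    k+-residues⁻ {y} (inj₁ k+y≡a) = inj₁ (trans (sym (k+-residue y)) k+y≡a)
    k+-residues⁻ {y} (inj₂ k+y≡b) = inj₂ (trans (sym (k+-residue y)) k+y≡b)
    sum≡n : k * (r + s) + sum ρ ≡ n
    sum≡n = begin
      k * (r + s) + sum ρ               ≡⟨ cong (λ l → k * l + sum ρ) (cong₂ _+_ (ℓa≡ c) (ℓb≡ c)) ⟨
      k * (ℓ k a (raise ρ) + ℓ k b (raise ρ)) + sum ρ ≡⟨ cong (λ l → k * l + sum ρ) (length≡ℓa+ℓb (residues c)) ⟨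
      k * length (raise ρ) + sum ρ      ≡⟨ cong (λ l → k * l + sum ρ) (List.length-map (_+_ k) ρ) ⟩
      k * length ρ + sum ρ              ≡⟨ sum-raise ρ ⟨
      sum (raise ρ)                     ≡⟨ sum≡ c ⟩
      n                                 ∎

  unraise : ∀ {ρ} → All (k <_) ρ → ∃[ ρ₀ ] raise ρ₀ ≡ ρ × All (1 ≤_) ρ₀
  unraise [] = [] , refl , []
  unraise {y ∷ _} (k<y ∷ k<ρ) with unraise k<ρ
  ... | ρ₀ , refl , pos =
    y ∸ k ∷ ρ₀ , cong (_∷ raise ρ₀) (ℕₚ.m+[n∸m]≡n (ℕₚ.<⇒≤ k<y)) , ℕₚ.m<n⇒0<n∸m k<y ∷ pos

  head-bound : ∀ {n r s y ρ} → SortedCell n r s (y ∷ ρ) → All (y ≤_) (y ∷ ρ)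
  head-bound c = Linkedₚ.Linked⇒All ℕₚ.≤-trans ℕₚ.≤-refl (ascending c)

  1≤k*[1+t] : ∀ t → 1 ≤ k * suc t
  1≤k*[1+t] t = >-nonZero⁻¹ (k * suc t) {{ℕₚ.m*n≢0 k (suc t)}}

  -- A cell either has least part a, or it has no part a; in the latter case it either has least
  -- part b, or all its parts exceed k and subtracting k from each of its t = r + s parts gives a cell.
  mutual
    cells : ∀ n → Acc _<_ n → ℕ → ℕ → List (List ℕ)
    cells n wf r s = cellsFrom-a n wf r s ++ cells≢a n wf r s

    cellsFrom-a : ∀ n → Acc _<_ n → ℕ → ℕ → List (List ℕ)
    cellsFrom-a n _          zero    s = []
    cellsFrom-a n (acc rs) (suc r) s with a ≤? n
    ... | yes a≤n = map (a ∷_) (cells (n ∸ a) (rs (ℕₚ.∸-monoʳ-< 1≤a a≤n)) r s)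
    ... | no  _   = []

    cells≢a : ∀ n → Acc _<_ n → ℕ → ℕ → List (List ℕ)
    cells≢a n wf r s = cellsFrom-b n wf r s ++ cells>k n wf r s (r + s)

    cellsFrom-b : ∀ n → Acc _<_ n → ℕ → ℕ → List (List ℕ)
    cellsFrom-b n _          r zero    = []
    cellsFrom-b n (acc rs) r (suc s) with b ≤? n
    ... | yes b≤n = map (b ∷_) (cells≢a (n ∸ b) (rs (ℕₚ.∸-monoʳ-< 1≤b b≤n)) r s)
    ... | no  _   = []

    cells>k : ∀ n → Acc _<_ n → (r s t : ℕ) → List (List ℕ)
    cells>k n       (acc rs) r s (suc t) with k * suc t ≤? n
    ... | yes kt≤n = map raise (cells (n ∸ k * suc t) (rs (ℕₚ.∸-monoʳ-< (1≤k*[1+t] t) kt≤n)) r s)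
    ... | no  _    = []
    cells>k zero    _        r s zero    = [] ∷ []
    cells>k (suc n) _        r s zero    = []

  mutual
    cells-sound : ∀ n wf r s {ρ} → ρ ∈ cells n wf r s → SortedCell n r s ρ
    cells-sound n wf r s ρ∈ with ∈-++⁻ (cellsFrom-a n wf r s) ρ∈
    ... | inj₁ ρ∈₁ = cellsFrom-a-sound n wf r s ρ∈₁
    ... | inj₂ ρ∈₂ = proj₁ (cells≢a-sound n wf r s ρ∈₂)

    cellsFrom-a-sound : ∀ n wf r s {ρ} → ρ ∈ cellsFrom-a n wf r s → SortedCell n r s ρ
    cellsFrom-a-sound n (acc rs) (suc r) s ρ∈ with a ≤? n
    ... | yes a≤n with ∈-map⁻ (a ∷_) ρ∈
    ...   | ρ′ , ρ′∈ , refl = subst (λ m → SortedCell m (suc r) s (a ∷ ρ′)) (ℕₚ.m+[n∸m]≡n a≤n)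
                                     (a∷-cell (cells-sound (n ∸ a) _ r s ρ′∈))

    cells≢a-sound : ∀ n wf r s {ρ} → ρ ∈ cells≢a n wf r s → SortedCell n r s ρ × WithoutA ρ
    cells≢a-sound n wf r s ρ∈ with ∈-++⁻ (cellsFrom-b n wf r s) ρ∈
    ... | inj₁ ρ∈₁ = cellsFrom-b-sound n wf r s ρ∈₁
    ... | inj₂ ρ∈₂ = cells>k-sound n wf r s (r + s) refl ρ∈₂

    cellsFrom-b-sound : ∀ n wf r s {ρ} → ρ ∈ cellsFrom-b n wf r s → SortedCell n r s ρ × WithoutA ρ
    cellsFrom-b-sound n (acc rs) r (suc s) ρ∈ with b ≤? n
    ... | yes b≤n with ∈-map⁻ (b ∷_) ρ∈
    ...   | ρ′ , ρ′∈ , refl with cells≢a-sound (n ∸ b) _ r s ρ′∈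
    ...     | c , ≢as = subst (λ m → SortedCell m r (suc s) (b ∷ ρ′)) (ℕₚ.m+[n∸m]≡n b≤n) (b∷-cell c ≢as)
                      , (ℕₚ.<⇒≢ a<b ∘ sym) ∷ ≢as

    cells>k-sound : ∀ n wf r s t → r + s ≡ t → ∀ {ρ} → ρ ∈ cells>k n wf r s t →
                    SortedCell n r s ρ × WithoutA ρ
    cells>k-sound zero (acc _) r s zero r+s≡0 (here refl)
      rewrite ℕₚ.m+n≡0⇒m≡0 r r+s≡0 | ℕₚ.m+n≡0⇒n≡0 r r+s≡0 = []-cell , []
    cells>k-sound n (acc rs) r s (suc t) r+s≡1+t ρ∈ with k * suc t ≤? n
    ... | yes kt≤n with ∈-map⁻ raise ρ∈
    ...   | ρ′ , ρ′∈ , refl =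
      subst (λ m → SortedCell m r s (raise ρ′)) weight≡ (raise-cell (cells-sound _ _ r s ρ′∈)) , raise-WithoutA ρ′
      where
      weight≡ : k * (r + s) + (n ∸ k * suc t) ≡ n
      weight≡ = trans (cong (λ u → k * u + (n ∸ k * suc t)) r+s≡1+t) (ℕₚ.m+[n∸m]≡n kt≤n)

  ≢a-parts : ∀ {n r s y ρ} → SortedCell n r s (y ∷ ρ) → y ≢ a → WithoutA (y ∷ ρ)
  ≢a-parts {y = y} c y≢a = All.map (λ y≤z z≡a → ℕₚ.<⇒≱ a<y (subst (y ≤_) z≡a y≤z)) (head-bound c)
    where
    1≤y : 1 ≤ y
    1≤y = All.head (positive c)
    res : HasResidue y
    res = All.head (residues c)
    a<y : a < y
    a<y = ℕₚ.≤∧≢⇒< (a≤part 1≤y res) (y≢a ∘ sym)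

  >k-parts : ∀ {n r s y ρ} → SortedCell n r s (y ∷ ρ) → y ≢ a → y ≢ b → All (k <_) (y ∷ ρ)
  >k-parts c y≢a y≢b with part-cases (All.head (positive c)) (All.head (residues c))
  ... | inj₁ y≡a         = contradiction y≡a y≢a
  ... | inj₂ (inj₁ y≡b)  = contradiction y≡b y≢b
  ... | inj₂ (inj₂ k<y)  = All.map (ℕₚ.<-≤-trans k<y) (head-bound c)

  mutual
    cells-complete : ∀ n wf r s {ρ} → SortedCell n r s ρ → ρ ∈ cells n wf r s
    cells-complete n wf r s {[]} c = ∈-++⁺ʳ (cellsFrom-a n wf r s) (cells≢a-complete n wf r s c [])
    cells-complete n wf r s {y ∷ ρ} c with y ≟ a
    ... | no y≢a = ∈-++⁺ʳ (cellsFrom-a n wf r s) (cells≢a-complete n wf r s c (≢a-parts c y≢a))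
    ... | yes refl with a∷-cell⁻ c
    ...   | a≤n , refl , c′ = ∈-++⁺ˡ (cellsFrom-a-complete n wf (ℓ k a ρ) s a≤n c′)

    cellsFrom-a-complete : ∀ n wf r s {ρ} → a ≤ n → SortedCell (n ∸ a) r s ρ →
                           a ∷ ρ ∈ cellsFrom-a n wf (suc r) s
    cellsFrom-a-complete n (acc rs) r s a≤n c with a ≤? n
    ... | yes a≤n′ = ∈-map⁺ (a ∷_) (cells-complete (n ∸ a) _ r s c)
    ... | no  a≰n  = contradiction a≤n a≰n

    cells≢a-complete : ∀ n wf r s {ρ} → SortedCell n r s ρ → WithoutA ρ → ρ ∈ cells≢a n wf r s
    cells≢a-complete n (acc rs) r s {[]} c _
      rewrite sym (sum≡ c) | sym (ℓa≡ c) | sym (ℓb≡ c) = ∈-++⁺ʳ (cellsFrom-b 0 (acc rs) 0 0) (here refl)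
    cells≢a-complete n wf r s {y ∷ ρ} c ≢as with y ≟ b
    ... | yes refl with b∷-cell⁻ c
    ...   | b≤n , refl , c′ = ∈-++⁺ˡ (cellsFrom-b-complete n wf r (ℓ k b ρ) b≤n c′ (All.tail ≢as))
    cells≢a-complete n wf r s {y ∷ ρ} c ≢as | no y≢b with unraise (>k-parts c (All.head ≢as) y≢b)
    ... | ρ₀ , raise≡ , pos = subst (_∈ cells≢a n wf r s) raise≡ (∈-++⁺ʳ (cellsFrom-b n wf r s)
        (cells>k-complete n wf r s (r + s) refl r+s≢0 pos (subst (SortedCell n r s) (sym raise≡) c)))
      where
      r+s≢0 : r + s ≢ 0
      r+s≢0 r+s≡0 = contradiction (trans (length≡ℓa+ℓb (residues c)) (trans (cong₂ _+_ (ℓa≡ c) (ℓb≡ c)) r+s≡0))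
                                  λ ()

    cellsFrom-b-complete : ∀ n wf r s {ρ} → b ≤ n → SortedCell (n ∸ b) r s ρ → WithoutA ρ →
                           b ∷ ρ ∈ cellsFrom-b n wf r (suc s)
    cellsFrom-b-complete n (acc rs) r s b≤n c ≢as with b ≤? n
    ... | yes b≤n′ = ∈-map⁺ (b ∷_) (cells≢a-complete (n ∸ b) _ r s c ≢as)
    ... | no  b≰n  = contradiction b≤n b≰n

    cells>k-complete : ∀ n wf r s t {ρ} → r + s ≡ t → t ≢ 0 → All (1 ≤_) ρ →
                       SortedCell n r s (raise ρ) → raise ρ ∈ cells>k n wf r s t
    cells>k-complete n wf       r s zero    _ t≢0 _ _ = contradiction refl t≢0
    cells>k-complete n (acc rs) r s (suc t) {ρ} r+s≡1+t _ pos c with raise-cell⁻ pos c | k * suc t ≤? n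
    ... | _    , c₀ | yes _   =
      ∈-map⁺ raise (cells-complete (n ∸ k * suc t) _ r s (subst (λ u → SortedCell (n ∸ k * u) r s ρ) r+s≡1+t c₀))
    ... | k[r+s]≤n , _ | no kt≰n = contradiction (subst (λ u → k * u ≤ n) r+s≡1+t k[r+s]≤n) kt≰n

  cellsFrom-a-head : ∀ n wf r s {ρ} → ρ ∈ cellsFrom-a n wf r s → ∃[ ρ′ ] ρ ≡ a ∷ ρ′
  cellsFrom-a-head n (acc rs) (suc r) s ρ∈ with a ≤? n
  ... | yes _ with ∈-map⁻ (a ∷_) ρ∈
  ...   | ρ′ , _ , ρ≡ = ρ′ , ρ≡

  cellsFrom-b-head : ∀ n wf r s {ρ} → ρ ∈ cellsFrom-b n wf r s → ∃[ ρ′ ] ρ ≡ b ∷ ρ′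
  cellsFrom-b-head n (acc rs) r (suc s) ρ∈ with b ≤? n
  ... | yes _ with ∈-map⁻ (b ∷_) ρ∈
  ...   | ρ′ , _ , ρ≡ = ρ′ , ρ≡

  cells>k-parts : ∀ n wf r s t {ρ} → ρ ∈ cells>k n wf r s t → All (k <_) ρ
  cells>k-parts n (acc rs) r s (suc t) ρ∈ with k * suc t ≤? n
  ... | yes _ with ∈-map⁻ raise ρ∈
  ...   | ρ′ , ρ′∈ , refl = Allₚ.map⁺ (All.map (ℕₚ.m<m+n k) (positive (cells-sound _ _ r s ρ′∈)))
  cells>k-parts zero (acc rs) r s zero (here refl) = []

  mutual
    cells-unique : ∀ n wf r s → Unique (cells n wf r s)
    cells-unique n wf r s = Uniqueₚ.++⁺ (cellsFrom-a-unique n wf r s) (cells≢a-unique n wf r s) disjoint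
      where
      disjoint : Disjoint (cellsFrom-a n wf r s) (cells≢a n wf r s)
      disjoint (ρ∈₁ , ρ∈₂) with cellsFrom-a-head n wf r s ρ∈₁
      ... | _ , refl = All.head (proj₂ (cells≢a-sound n wf r s ρ∈₂)) refl

    cellsFrom-a-unique : ∀ n wf r s → Unique (cellsFrom-a n wf r s)
    cellsFrom-a-unique n wf       zero    s = []
    cellsFrom-a-unique n (acc rs) (suc r) s with a ≤? n
    ... | yes _ = Uniqueₚ.map⁺ List.∷-injectiveʳ (cells-unique _ _ r s)
    ... | no  _ = []

    cells≢a-unique : ∀ n wf r s → Unique (cells≢a n wf r s)
    cells≢a-unique n wf r s =
      Uniqueₚ.++⁺ (cellsFrom-b-unique n wf r s) (cells>k-unique n wf r s (r + s)) disjoint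
      where
      disjoint : Disjoint (cellsFrom-b n wf r s) (cells>k n wf r s (r + s))
      disjoint (ρ∈₁ , ρ∈₂) with cellsFrom-b-head n wf r s ρ∈₁
      ... | _ , refl = ℕₚ.<⇒≱ (All.head (cells>k-parts n wf r s (r + s) ρ∈₂)) b≤k

    cellsFrom-b-unique : ∀ n wf r s → Unique (cellsFrom-b n wf r s)
    cellsFrom-b-unique n wf       r zero    = []
    cellsFrom-b-unique n (acc rs) r (suc s) with b ≤? n
    ... | yes _ = Uniqueₚ.map⁺ List.∷-injectiveʳ (cells≢a-unique _ _ r s)
    ... | no  _ = []

    cells>k-unique : ∀ n wf r s t → Unique (cells>k n wf r s t)
    cells>k-unique n (acc rs) r s (suc t) with k * suc t ≤? n
    ... | yes _ = Uniqueₚ.map⁺ (List.map-injective (ℕₚ.+-cancelˡ-≡ k _ _)) (cells-unique _ _ r s)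
    ... | no  _ = []
    cells>k-unique zero    (acc rs) r s zero = [] ∷ []
    cells>k-unique (suc n) (acc rs) r s zero = []

  open Gaussian k using (qᵏ^_; qᵏ^-cong)
  open CellSeries k a b (ℕₚ.<⇒≤ a<b)

  +length-++ : ∀ (xs ys : List (List ℕ)) → + length (xs ++ ys) ≡ + length xs ℤ.+ + length ys
  +length-++ xs ys = cong +_ (List.length-++ xs)

  +length-map : ∀ (f : List ℕ → List ℕ) xs → + length (map f xs) ≡ + length xs
  +length-map f xs = cong +_ (List.length-map f xs)

  +length-map-qPow-⊛ : ∀ e n (f : List ℕ → List ℕ) xs g → e ≤ n →
    + length xs ≡ g (n ∸ e) → + length (map f xs) ≡ (qPow e ⊛ g) n
  +length-map-qPow-⊛ e n f xs g e≤n eq = trans (+length-map f xs) (trans eq (sym (qPow-⊛ e g n e≤n)))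

  mutual
    cells-length : ∀ n wf r s → + length (cells n wf r s) ≡ cellSeries r s n
    cells-length n wf zero s = trans (cells≢a-length n wf zero s) (sym (at (cellSeries-zeroˡ s) n))
    cells-length n wf (suc r) s = begin
      + length (cellsFrom-a n wf (suc r) s ++ cells≢a n wf (suc r) s)
        ≡⟨ +length-++ (cellsFrom-a n wf (suc r) s) (cells≢a n wf (suc r) s) ⟩
      + length (cellsFrom-a n wf (suc r) s) ℤ.+ + length (cells≢a n wf (suc r) s)
        ≡⟨ cong₂ ℤ._+_ (cellsFrom-a-length n wf r s) (cells≢a-length n wf (suc r) s) ⟩
      (qPow a ⊛ cellSeries r s) n ℤ.+ cellSeries≢a (suc r) s n
        ≡⟨ at (cellSeries-sucˡ r s) n ⟨
      cellSeries (suc r) s n ∎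
      where open ≡-Reasoning

    cellsFrom-a-length : ∀ n wf r s → + length (cellsFrom-a n wf (suc r) s) ≡ (qPow a ⊛ cellSeries r s) n
    cellsFrom-a-length n (acc rs) r s with a ≤? n
    ... | yes a≤n = +length-map-qPow-⊛ a n (a ∷_) (cells (n ∸ a) _ r s) (cellSeries r s) a≤n
                                         (cells-length (n ∸ a) (rs (ℕₚ.∸-monoʳ-< 1≤a a≤n)) r s)
    ... | no  a≰n = sym (qPow-⊛-below a (cellSeries r s) n (ℕₚ.≰⇒> a≰n))

    cells≢a-length : ∀ n wf r s → + length (cells≢a n wf r s) ≡ cellSeries≢a r s n
    cells≢a-length n wf r (suc s) = begin
      + length (cellsFrom-b n wf r (suc s) ++ cells>k n wf r (suc s) (r + suc s))
        ≡⟨ +length-++ (cellsFrom-b n wf r (suc s)) (cells>k n wf r (suc s) (r + suc s)) ⟩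
      + length (cellsFrom-b n wf r (suc s)) ℤ.+ + length (cells>k n wf r (suc s) (r + suc s))
        ≡⟨ cong₂ ℤ._+_ (cellsFrom-b-length n wf r s) (cells>k-length n wf r (suc s) (r + suc s) r+1+s≢0) ⟩
      (qPow b ⊛ cellSeries≢a r s) n ℤ.+ (qᵏ^ (r + suc s) ⊛ cellSeries r (suc s)) n
        ≡⟨ at (cellSeries≢a-sucʳ r s) n ⟨
      cellSeries≢a r (suc s) n ∎
      where
      open ≡-Reasoning
      r+1+s≢0 : r + suc s ≢ 0
      r+1+s≢0 r+1+s≡0 = contradiction (trans (sym (ℕₚ.+-suc r s)) r+1+s≡0) λ ()
    cells≢a-length n wf (suc r) zero =
      trans (cells>k-length n wf (suc r) 0 (suc r + 0) λ ())
            (at (⊛-congʳ (cellSeries (suc r) 0) (qᵏ^-cong (ℕₚ.+-identityʳ (suc r)))) n)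
    cells≢a-length zero    (acc _) zero zero = sym (at cellSeries≢a-zero 0)
    cells≢a-length (suc n) (acc _) zero zero = sym (at cellSeries≢a-zero (suc n))

    cellsFrom-b-length : ∀ n wf r s → + length (cellsFrom-b n wf r (suc s)) ≡ (qPow b ⊛ cellSeries≢a r s) n
    cellsFrom-b-length n (acc rs) r s with b ≤? n
    ... | yes b≤n = +length-map-qPow-⊛ b n (b ∷_) (cells≢a (n ∸ b) _ r s) (cellSeries≢a r s) b≤n
                                         (cells≢a-length (n ∸ b) (rs (ℕₚ.∸-monoʳ-< 1≤b b≤n)) r s)
    ... | no  b≰n = sym (qPow-⊛-below b (cellSeries≢a r s) n (ℕₚ.≰⇒> b≰n))

    cells>k-length : ∀ n wf r s t → t ≢ 0 → + length (cells>k n wf r s t) ≡ (qᵏ^ t ⊛ cellSeries r s) n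
    cells>k-length n wf       r s zero    t≢0 = contradiction refl t≢0
    cells>k-length n (acc rs) r s (suc t) _ with k * suc t ≤? n
    ... | yes kt≤n = +length-map-qPow-⊛ (k * suc t) n raise (cells (n ∸ k * suc t) _ r s) (cellSeries r s) kt≤n
                       (cells-length (n ∸ k * suc t) (rs (ℕₚ.∸-monoʳ-< (1≤k*[1+t] t) kt≤n)) r s)
    ... | no  kt≰n = sym (qPow-⊛-below (k * suc t) (cellSeries r s) n (ℕₚ.≰⇒> kt≰n))

  ℓ-reverse : ∀ c ρ → ℓ k c (reverse ρ) ≡ ℓ k c ρ
  ℓ-reverse c ρ = ↭ₚ.↭-length (↭ₚ.filter-↭ (λ x → x % k ≟ c % k) (↭ₚ.↭-reverse ρ))

  reverse-cell : ∀ {n r s ρ} → SortedCell n r s ρ → PartCell k a b n r s (reverse ρ)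
  reverse-cell {ρ = ρ} c =
    ((Linked-reverse ℕₚ.≤-trans (ascending c) , All-reverse (positive c)) , All-reverse (residues c)) ,
    trans (sum-reverse ρ) (sum≡ c) , trans (ℓ-reverse a ρ) (ℓa≡ c) , trans (ℓ-reverse b ρ) (ℓb≡ c)

  reverse-partCell : ∀ {n r s π} → PartCell k a b n r s π → SortedCell n r s (reverse π)
  reverse-partCell {π = π} (((descending , positive) , residues) , sum≡ , ℓa≡ , ℓb≡) = record
    { ascending = Linked-reverse (flip ℕₚ.≤-trans) descending
    ; positive  = All-reverse positive
    ; residues  = All-reverse residues
    ; sum≡      = trans (sum-reverse π) sum≡
    ; ℓa≡       = trans (ℓ-reverse a π) ℓa≡
    ; ℓb≡       = trans (ℓ-reverse b π) ℓb≡
    }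

  partitions : ℕ → ℕ → ℕ → List (List ℕ)
  partitions n r s = map reverse (cells n (<-wellFounded n) r s)

  partitions-unique : ∀ n r s → Unique (partitions n r s)
  partitions-unique n r s = Uniqueₚ.map⁺ List.reverse-injective (cells-unique n _ r s)

  ∈-partitions⇔ : ∀ n r s π → π ∈ partitions n r s ⇔ PartCell k a b n r s π
  ∈-partitions⇔ n r s π = mk⇔ to from
    where
    to : π ∈ partitions n r s → PartCell k a b n r s π
    to π∈ with ∈-map⁻ reverse π∈
    ... | ρ , ρ∈ , refl = reverse-cell (cells-sound n _ r s ρ∈)
    from : PartCell k a b n r s π → π ∈ partitions n r s
    from c = subst (_∈ partitions n r s) (List.reverse-involutive π)
                   (∈-map⁺ reverse (cells-complete n _ r s (reverse-partCell c)))

  partitions-count : ∀ n r s → + length (partitions n r s) ≡ rhsCoeff k a b r s n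
  partitions-count n r s = begin
    + length (partitions n r s)               ≡⟨ +length-map reverse (cells n (<-wellFounded n) r s) ⟩
    + length (cells n (<-wellFounded n) r s)  ≡⟨ cells-length n (<-wellFounded n) r s ⟩
    cellSeries r s n                          ≡⟨ rhsCoeff≡cellSeries r s n ⟨
    rhsCoeff k a b r s n                      ∎
    where open ≡-Reasoning

mainTheorem1 : (k a b : ℕ) .{{_ : NonZero k}} → 1 ≤ a → a < b → b ≤ k →
    (r s n : ℕ) →
    ∃[ L ] (Unique L × (∀ (π : List ℕ) → (π ∈ L) ⇔ PartCell k a b n r s π)
            × (+ length L ≡ rhsCoeff k a b r s n))
mainTheorem1 k a b 1≤a a<b b≤k r s n =
  partitions n r s , partitions-unique n r s , ∈-partitions⇔ n r s , partitions-count n r s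
  where open Enumeration k a b 1≤a a<b b≤k
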